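{- Let $P,Q\in\mathbb Z$ with $Q\ne0$, $f(t)=t^2-Pt+Q$ with roots $\theta_1,\theta_2$, $D=P^2-4Q\neq0$, and let $p$ be a prime with $p\nmid Q$; write $D=p^sD_0$ with $s\ge0$, $p\nmid D_0$. For $R\in\{\mathbb Q,\mathbb Z_{(p)},\mathbb F_p\}$ let $G_R(f)$ be as in the context, with classes written $[w_1:w_0]$. (1) If $f$ is irreducible over $\mathbb Q$, then $G_{\mathbb Q}(f)\xrightarrow{\sim}\mathbb Q(\theta_1)^{\times}/\mathbb Q^{\times}$, $[w_1:w_0]\mapsto w_1-w_0\theta_1\bmod\mathbb Q^{\times}$. If $f$ is reducible over $\mathbb Q$, then $G_{\mathbb Q}(f)\xrightarrow{\sim}\mathbb Q^{\times}$, $[w_1:w_0]\mapsto(w_1-w_0\theta_1)(w_1-w_0\theta_2)^{ -1}$. (2) If $f$ is irreducible over $\mathbb Q$, then $G_{\mathbb Z_{(p)}}(f)\xrightarrow{\sim}\mathbb Z_{(p)}[\theta_1]^{\times}/\mathbb Z_{(p)}^{\times}$, $[w_1:w_0]\mapsto w_1-w_0\theta_1\bmod\mathbb Z_{(p)}^{\times}$. If $f$ is reducible over $\mathbb Q$, then $G_{\mathbb Z_{(p)}}(f)$ is isomorphic to $\mathbb Z_{(p)}^{\times}$ if $p\nmid D$ and to $1+p^{s/2}\mathbb Z_{(p)}$ if $p\mid D$, via $[w_1:w_0]\mapsto(w_1-w_0\theta_1)(w_1-w_0\theta_2)^{ -1}$. (3)(i) If $f\bmod p$ is irreducible over $\mathbb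 F_p$, then $G_{\mathbb F_p}(f)\xrightarrow{\sim}\mathbb F_p(\theta_1)^{\times}/\mathbb F_p^{\times}$, $[w_1:w_0]\mapsto w_1-w_0\theta_1\bmod\mathbb F_p^{\times}$. (ii) If $f\bmod p$ is reducible over $\mathbb F_p$: if $p\nmid D$, then $G_{\mathbb F_p}(f)\xrightarrow{\sim}\mathbb F_p^{\times}$, $[w_1:w_0]\mapsto(w_1-w_0\theta_1)(w_1-w_0\theta_2)^{ -1}$; if $p\mid D$, then $G_{\mathbb F_p}(f)\xrightarrow{\sim}\mathbb F_p$ (additive group), $[w_1:w_0]\mapsto -w_0(w_1-w_0\theta)^{ -1}$, where $\theta$ is the double root of $f\bmod p$.
   Context: For an integral domain $R$ in which $Q$ is a unit (with $P,Q$ mapped into $R$), let $\mathscr S(f,R)^{\times}$ be the set of sequences $(w_n)_{n\in\mathbb Z}$ in $R$ with $w_{n+2}-Pw_{n+1}+Qw_n=0$ for all $n$ and $\Lambda(w_1,w_0):=w_1^2-Pw_0w_1+Qw_0^2\in R^{\times}$. It is an abelian group with product $(w_n)*(v_n)=(u_n)$ determined by $u_1=w_1v_1-Qw_0v_0$, $u_0=w_0v_1+w_1v_0-Pw_0v_0$ (this is the multiplication of $(R[t]/(f))^{\times}$ under $(w_n)\mapsto w_1-w_0t$). Two sequences are equivalent, ${\bf w}\sim{\bf v}$, if $w_n=\lambda v_n$ for all $n$ for some $\lambda\in R^{\times}$; $G_R(f):=\mathscr S(f,R)^{\times}/\sim$ with the induced group structure, and $[w_1:w_0]$ denotes the class of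 the sequence with initial terms $w_1,w_0$. For $R=\mathbb F_p$, $P,Q,\theta_i$ are reduced mod $p$. For reducible $f$ over $\mathbb Q$, $\theta_1,\theta_2\in\mathbb Z$. -}

module Defs where

open import Data.Nat as ℕ using (ℕ; _∸_)
import Data.Nat.Divisibility as ℕD
open import Data.Integer as ℤ using (ℤ; +_)
import Data.Integer.Divisibility as ℤD
open import Data.Rational as ℚ using (ℚ; 0ℚ; 1ℚ)
import Data.Rational.Properties as ℚP
open import Data.Product using (Σ; _×_; _,_; proj₁; proj₂)
open import Data.Unit using (⊤)
open import Relation.Nullary using (¬_; yes; no)
open import Relation.Binary.PropositionalEquality using (_≡_)

-- An "ambient" commutative ring A together with a membership predicate
-- `In` cutting out the ring R we work in (R ⊆ A), and the equality of A.
--   * R = ℚ      : A = ℚ, equality ≡, In = everything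
--   * R = ℤ_(p)  : A = ℚ, equality ≡, In q = p ∤ denominator q
--   * R = 𝔽_p    : A = ℤ, equality = congruence mod p, In = everything

record Amb : Set₁ where
  infixl 6 _+_
  infixl 7 _*_
  infix 4 _≈_
  infix 8 -_
  field
    A    : Set
    _≈_  : A → A → Set
    _+_  : A → A → A
    _*_  : A → A → A
    -_   : A → A
    0#   : A
    1#   : A
    In   : A → Set

module AmbOps (𝔸 : Amb) where
  open Amb 𝔸 public
  infixl 6 _-_

  _-_ : A → A → A
  x - y = x + (- y)

  IsUnit : A → Set
  IsUnit x = In x × Σ A (λ y → In y × ((x * y) ≈ 1#))

  Λ : (P Q w₁ w₀ : A) → A
  Λ P Q w₁ w₀ = w₁ * w₁ - P * w₀ * w₁ + Q * w₀ * w₀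

record Seq (𝔸 : Amb) (P Q : Amb.A 𝔸) : Set where
  open AmbOps 𝔸
  field
    w     : ℤ → A
    inR   : ∀ n → In (w n)
    rec   : ∀ n → w (n ℤ.+ + 2) - P * w (n ℤ.+ + 1) + Q * w n ≈ 0#
    unitΛ : IsUnit (Λ P Q (w (+ 1)) (w (+ 0)))
open Seq public

module _ (𝔸 : Amb) (P Q : Amb.A 𝔸) where
  open AmbOps 𝔸

  -- the equivalence relation defining G_R(f) = 𝒮(f,R)^× / ∼
  _∼_ : Seq 𝔸 P Q → Seq 𝔸 P Q → Set
  u ∼ v = Σ A (λ c → IsUnit c × (∀ n → w u n ≈ c * w v n))

  IsProd : (w' v u : Seq 𝔸 P Q) → Set
  IsProd w' v u =
      (w u (+ 1) ≈ w w' (+ 1) * w v (+ 1) - Q * w w' (+ 0) * w v (+ 0))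
    × (w u (+ 0) ≈ w w' (+ 0) * w v (+ 1) + w w' (+ 1) * w v (+ 0)
                     - P * w w' (+ 0) * w v (+ 0))

record Target : Set₁ where
  field
    T     : Set
    _≈T_  : T → T → Set
    _∙_   : T → T → T
    Elem  : T → Set

record IsIso (𝔸 : Amb) (P Q : Amb.A 𝔸) (𝕋 : Target)
             (φ : Seq 𝔸 P Q → Target.T 𝕋) : Set where
  open Target 𝕋
  field
    into  : ∀ u → Elem (φ u)
    resp  : ∀ u v → _∼_ 𝔸 P Q u v → φ u ≈T φ v
    inj   : ∀ u v → φ u ≈T φ v → _∼_ 𝔸 P Q u v
    surj  : ∀ y → Elem y → Σ (Seq 𝔸 P Q) (λ u → φ u ≈T y)
    hom   : ∀ u v r → IsProd 𝔸 P Q u v r → φ r ≈T (φ u ∙ φ v)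

module _ (𝔸 : Amb) (P Q : Amb.A 𝔸) where
  open AmbOps 𝔸

  -- R[θ] = R[t]/(t² − P t + Q); the pair (a , b) stands for a + b θ.
  _·θ_ : A × A → A × A → A × A
  (a , b) ·θ (c , d) = (a * c - Q * b * d , a * d + b * c + P * b * d)

  IsUnitθ : A × A → Set
  IsUnitθ (a , b) = In a × In b ×
    Σ (A × A) (λ cd → In (proj₁ cd) × In (proj₂ cd) ×
       (proj₁ ((a , b) ·θ cd) ≈ 1#) × (proj₂ ((a , b) ·θ cd) ≈ 0#))

  QuadModUnits : Target
  QuadModUnits = record
    { T = A × A
    ; _≈T_ = λ x y → Σ A (λ c → IsUnit c × (proj₁ x ≈ c * proj₁ y) × (proj₂ x ≈ c * proj₂ y))
    ; _∙_ = _·θ_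
    ; Elem = IsUnitθ }

  quadMap : Seq 𝔸 P Q → A × A
  quadMap u = (w u (+ 1) , - w u (+ 0))

  MulGroup : (A → Set) → Target
  MulGroup E = record { T = A ; _≈T_ = _≈_ ; _∙_ = _*_ ; Elem = E }

  AddGroup : Target
  AddGroup = record { T = A ; _≈T_ = _≈_ ; _∙_ = _+_ ; Elem = In }

  ratioMap : (inv : A → A) (θ₁ θ₂ : A) → Seq 𝔸 P Q → A
  ratioMap inv θ₁ θ₂ u = (w u (+ 1) - w u (+ 0) * θ₁) * inv (w u (+ 1) - w u (+ 0) * θ₂)

  additiveMap : (inv : A → A) (θ : A) → Seq 𝔸 P Q → A
  additiveMap inv θ u = (- w u (+ 0)) * inv (w u (+ 1) - w u (+ 0) * θ)

  Reducible : Set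
  Reducible = Σ A λ a → Σ A λ b → Σ A λ c → Σ A λ d →
    In a × In b × In c × In d × ¬ (a ≈ 0#) × ¬ (c ≈ 0#) ×
    (a * c ≈ 1#) × (a * d + b * c ≈ - P) × (b * d ≈ Q)

  Irreducible : Set
  Irreducible = ¬ Reducible

ℚAmb : Amb
ℚAmb = record { A = ℚ ; _≈_ = _≡_ ; _+_ = ℚ._+_ ; _*_ = ℚ._*_ ; -_ = ℚ.-_
              ; 0# = 0ℚ ; 1# = 1ℚ ; In = λ _ → ⊤ }

ℤₚAmb : ℕ → Amb
ℤₚAmb p = record { A = ℚ ; _≈_ = _≡_ ; _+_ = ℚ._+_ ; _*_ = ℚ._*_ ; -_ = ℚ.-_
                 ; 0# = 0ℚ ; 1# = 1ℚ ; In = λ q → ¬ (p ℕD.∣ ℚ.denominatorℕ q) }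

_≡_[mod_] : ℤ → ℤ → ℕ → Set
x ≡ y [mod p ] = (+ p) ℤD.∣ (x ℤ.- y)

𝔽Amb : ℕ → Amb
𝔽Amb p = record { A = ℤ ; _≈_ = λ x y → x ≡ y [mod p ] ; _+_ = ℤ._+_ ; _*_ = ℤ._*_
                ; -_ = ℤ.-_ ; 0# = + 0 ; 1# = + 1 ; In = λ _ → ⊤ }

ι : ℤ → ℚ
ι z = z ℚ./ 1

-- total inverse on ℚ (value at 0 irrelevant: only applied to nonzero arguments)
invℚ : ℚ → ℚ
invℚ q with q ℚP.≟ 0ℚ
... | yes _  = 0ℚ
... | no q≢0 = ℚ.1/_ q {{ℚ.≢-nonZero q≢0}}

-- inverse in 𝔽_p (p prime) via Fermat: x⁻¹ = x^(p−2) for x ≢ 0 mod p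
inv𝔽 : ℕ → ℤ → ℤ
inv𝔽 p x = x ℤ.^ (p ∸ 2)

disc : ℤ → ℤ → ℤ
disc P Q = P ℤ.* P ℤ.- ℤ.+ 4 ℤ.* Q

OnePlus : ℕ → ℕ → ℚ → Set
OnePlus p k x = Σ ℚ (λ y → ¬ (p ℕD.∣ ℚ.denominatorℕ y) × (x ≡ 1ℚ ℚ.+ ι (+ (p ℕ.^ k)) ℚ.* y))

module Submission where

-- A sequence in 𝒮(f,R)^× is determined by (w₁ , w₀), its product is the product of
-- w₁ − w₀θ in R[θ] = R[t]/(f), and Λ(w₁ , w₀) is the norm of w₁ − w₀θ; hence sequences are
-- the units of R[θ], and proportional sequences are the same class modulo R^×.
-- If f = (t − θ₁)(t − θ₂), the class of a unit is read off from the ratio of its two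
-- evaluations X = w₁ − w₀θ₁, Y = w₁ − w₀θ₂; since X − Y = −w₀δ with δ = θ₁ − θ₂, the
-- ratios are exactly the units ≡ 1 mod δ, all units when δ is invertible, and
-- 1 + p^(s/2)ℤ_(p) over ℤ_(p) because δ² = D.  For a double root θ, X = w₁ − w₀θ is a
-- unit and −w₀/X is additive.  Over 𝔽_p, x^(p−2) inverts x by Fermat's little theorem.

open import Defs
open import Algebra using (CommutativeRing)
open import Algebra.Structures using (IsCommutativeRing)
import Algebra.Solver.Ring
import Algebra.Solver.Ring.AlmostCommutativeRing as ACR
open import Level using (0ℓ)
open import Data.Nat as ℕ using (ℕ; zero; suc; _∸_; _/_)
import Data.Nat.Properties as ℕP
import Data.Nat.Divisibility as ℕD
import Data.Nat.Coprimality as Coprimality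
open import Data.Nat.DivMod using (m*n/n≡m)
open import Data.Nat.Primality using (Prime; euclidsLemma; ¬prime[0]; ¬prime[1]; prime⇒nonZero)
open import Data.Integer as ℤ using (ℤ; +_; -[1+_]; _⊖_; _◃_; sign; ∣_∣)
import Data.Integer.Properties as ℤP
import Data.Integer.Divisibility as ℤD
import Data.Integer.Divisibility.Signed as ℤS
open import Data.Integer.Tactic.RingSolver using (solve-∀)
open import Data.Rational as ℚ using (ℚ; mkℚ; toℚᵘ; 0ℚ; 1ℚ)
import Data.Rational.Properties as ℚP
open import Data.Rational.Unnormalised as ℚᵘ using (mkℚᵘ; *≡*)
import Data.Rational.Unnormalised.Properties as ℚᵘP
open import Data.Sign as Sign using (Sign)
open import Data.Maybe using (Maybe; just; nothing)
open import Data.Product using (Σ; _×_; _,_; proj₁; proj₂)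
open import Data.Sum using (_⊎_; inj₁; inj₂)
open import Data.Unit using (tt)
open import Data.Empty using (⊥-elim)
open import Relation.Nullary using (¬_; yes; no; contradiction)
open import Relation.Binary.PropositionalEquality as ≡ using (_≡_; _≢_)

module IntegerCoefficients (R : CommutativeRing 0ℓ 0ℓ) where
  open CommutativeRing R
  open import Relation.Binary.Reasoning.Setoid setoid
  open import Algebra.Properties.Semiring.Mult semiring using (×-homo-+; ×1-homo-*) renaming (_×_ to _×ᵐ_)
  open import Algebra.Properties.Ring ring using (-1*x≈-x)
  open import Algebra.Properties.AbelianGroup +-abelianGroup using (⁻¹-∙-comm)
  open import Algebra.Properties.Group +-group using (⁻¹-involutive; ε⁻¹≈ε)
  import Algebra.Properties.CommutativeSemigroup as CommutativeSemigroupProperties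
  open CommutativeSemigroupProperties +-commutativeSemigroup using () renaming (interchange to +-interchange)
  open CommutativeSemigroupProperties *-commutativeSemigroup using () renaming (interchange to *-interchange)

  fromℤ : ℤ → Carrier
  fromℤ (+ n)    = n ×ᵐ 1#
  fromℤ -[1+ n ] = - (suc n ×ᵐ 1#)

  fromℤ-⊖ : ∀ m n → fromℤ (m ⊖ n) ≈ m ×ᵐ 1# - n ×ᵐ 1#
  fromℤ-⊖ m       zero    = sym (trans (+-congˡ ε⁻¹≈ε) (+-identityʳ _))
  fromℤ-⊖ zero    (suc n) = sym (+-identityˡ _)
  fromℤ-⊖ (suc m) (suc n) = begin
    fromℤ (suc m ⊖ suc n)             ≡⟨ ≡.cong fromℤ (ℤP.[1+m]⊖[1+n]≡m⊖n m n) ⟩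
    fromℤ (m ⊖ n)                     ≈⟨ fromℤ-⊖ m n ⟩
    m ×ᵐ 1# - n ×ᵐ 1#                   ≈⟨ +-identityˡ _ ⟨
    0# + (m ×ᵐ 1# - n ×ᵐ 1#)            ≈⟨ +-congʳ (-‿inverseʳ 1#) ⟨
    (1# - 1#) + (m ×ᵐ 1# - n ×ᵐ 1#)     ≈⟨ +-interchange 1# (- 1#) (m ×ᵐ 1#) (- (n ×ᵐ 1#)) ⟩
    (1# + m ×ᵐ 1#) + (- 1# - n ×ᵐ 1#)   ≈⟨ +-congˡ (⁻¹-∙-comm 1# (n ×ᵐ 1#)) ⟩
    (1# + m ×ᵐ 1#) - (1# + n ×ᵐ 1#)     ∎

  fromℤ-+ : ∀ i j → fromℤ (i ℤ.+ j) ≈ fromℤ i + fromℤ j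
  fromℤ-+ (+ m)    (+ n)    = ×-homo-+ 1# m n
  fromℤ-+ (+ m)    -[1+ n ] = fromℤ-⊖ m (suc n)
  fromℤ-+ -[1+ m ] (+ n)    = trans (fromℤ-⊖ n (suc m)) (+-comm _ _)
  fromℤ-+ -[1+ m ] -[1+ n ] = begin
    - (suc (suc (m ℕ.+ n)) ×ᵐ 1#)      ≡⟨ ≡.cong (λ k → - (suc k ×ᵐ 1#)) (ℕP.+-suc m n) ⟨
    - ((suc m ℕ.+ suc n) ×ᵐ 1#)        ≈⟨ -‿cong (×-homo-+ 1# (suc m) (suc n)) ⟩
    - (suc m ×ᵐ 1# + suc n ×ᵐ 1#)       ≈⟨ ⁻¹-∙-comm _ _ ⟨
    - (suc m ×ᵐ 1#) - suc n ×ᵐ 1#       ∎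

  ⟦_⟧ₛ : Sign → Carrier
  ⟦ Sign.+ ⟧ₛ = 1#
  ⟦ Sign.- ⟧ₛ = - 1#

  ⟦⟧ₛ-* : ∀ s t → ⟦ s Sign.* t ⟧ₛ ≈ ⟦ s ⟧ₛ * ⟦ t ⟧ₛ
  ⟦⟧ₛ-* Sign.+ t      = sym (*-identityˡ _)
  ⟦⟧ₛ-* Sign.- Sign.+ = sym (*-identityʳ _)
  ⟦⟧ₛ-* Sign.- Sign.- = sym (trans (-1*x≈-x (- 1#)) (⁻¹-involutive 1#))

  fromℤ-◃ : ∀ s n → fromℤ (s ◃ n) ≈ ⟦ s ⟧ₛ * (n ×ᵐ 1#)
  fromℤ-◃ s      zero    = sym (zeroʳ _)
  fromℤ-◃ Sign.+ (suc n) = sym (*-identityˡ _)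
  fromℤ-◃ Sign.- (suc n) = sym (-1*x≈-x _)

  fromℤ-signAbs : ∀ i → fromℤ i ≈ ⟦ sign i ⟧ₛ * (∣ i ∣ ×ᵐ 1#)
  fromℤ-signAbs i = trans (reflexive (≡.cong fromℤ (≡.sym (ℤP.◃-inverse i)))) (fromℤ-◃ (sign i) ∣ i ∣)

  fromℤ-* : ∀ i j → fromℤ (i ℤ.* j) ≈ fromℤ i * fromℤ j
  fromℤ-* i j = begin
    fromℤ (sign i Sign.* sign j ◃ ∣ i ∣ ℕ.* ∣ j ∣)
      ≈⟨ fromℤ-◃ (sign i Sign.* sign j) (∣ i ∣ ℕ.* ∣ j ∣) ⟩
    ⟦ sign i Sign.* sign j ⟧ₛ * ((∣ i ∣ ℕ.* ∣ j ∣) ×ᵐ 1#)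
      ≈⟨ *-cong (⟦⟧ₛ-* (sign i) (sign j)) (×1-homo-* ∣ i ∣ ∣ j ∣) ⟩
    (⟦ sign i ⟧ₛ * ⟦ sign j ⟧ₛ) * ((∣ i ∣ ×ᵐ 1#) * (∣ j ∣ ×ᵐ 1#))
      ≈⟨ *-interchange _ _ _ _ ⟩
    (⟦ sign i ⟧ₛ * (∣ i ∣ ×ᵐ 1#)) * (⟦ sign j ⟧ₛ * (∣ j ∣ ×ᵐ 1#))
      ≈⟨ *-cong (fromℤ-signAbs i) (fromℤ-signAbs j) ⟨
    fromℤ i * fromℤ j ∎

  fromℤ-neg : ∀ i → fromℤ (ℤ.- i) ≈ - fromℤ i
  fromℤ-neg (+ zero)  = sym ε⁻¹≈ε
  fromℤ-neg (+ suc n) = refl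
  fromℤ-neg -[1+ n ]  = sym (⁻¹-involutive _)

  private
    almostCommutativeRing : ACR.AlmostCommutativeRing 0ℓ 0ℓ
    almostCommutativeRing = ACR.fromCommutativeRing R

    fromℤ-morphism : ACR._-Raw-AlmostCommutative⟶_ ℤ.+-*-rawRing almostCommutativeRing
    fromℤ-morphism = record
      { ⟦_⟧ = fromℤ ; +-homo = fromℤ-+ ; *-homo = fromℤ-* ; -‿homo = fromℤ-neg
      ; 0-homo = refl ; 1-homo = +-identityʳ 1# }

    fromℤ-≟ : ∀ i j → Maybe (fromℤ i ≈ fromℤ j)
    fromℤ-≟ i j with i ℤ.≟ j
    ... | yes ≡.refl = just refl
    ... | no _       = nothing

  open Algebra.Solver.Ring ℤ.+-*-rawRing almostCommutativeRing fromℤ-morphism fromℤ-≟ public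
    using (solve; _:=_; _:+_; _:*_; :-_; _:-_; con)

record IsRingWithSubring (𝔸 : Amb) : Set where
  open Amb 𝔸
  field
    isCommutativeRing : IsCommutativeRing _≈_ _+_ _*_ -_ 0# 1#
    In-resp : ∀ {x y} → x ≈ y → In x → In y
    In-+    : ∀ {x y} → In x → In y → In (x + y)
    In-*    : ∀ {x y} → In x → In y → In (x * y)
    In-neg  : ∀ {x} → In x → In (- x)
    In-1    : In 1#

module RingWithSubring (𝔸 : Amb) (laws : IsRingWithSubring 𝔸) where
  open AmbOps 𝔸
  open IsRingWithSubring laws

  commutativeRing : CommutativeRing 0ℓ 0ℓ
  commutativeRing = record
    { Carrier = A ; _≈_ = _≈_ ; _+_ = _+_ ; _*_ = _*_ ; -_ = -_ ; 0# = 0# ; 1# = 1#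
    ; isCommutativeRing = isCommutativeRing }

  open CommutativeRing commutativeRing
    using (refl; sym; trans; setoid; +-cong; +-congˡ; +-congʳ; *-cong; *-congˡ; *-congʳ; -‿cong
          ; *-assoc; *-comm; *-identityˡ; *-identityʳ; +-identityˡ)
  open IntegerCoefficients commutativeRing using (solve; _:=_; _:+_; _:*_; :-_; _:-_; con)
  open import Relation.Binary.Reasoning.Setoid setoid

  In-− : ∀ {x y} → In x → In y → In (x - y)
  In-− x∈R y∈R = In-+ x∈R (In-neg y∈R)

  -‿cong₂ : ∀ {x y z t} → x ≈ y → z ≈ t → x - z ≈ y - t
  -‿cong₂ x≈y z≈t = +-cong x≈y (-‿cong z≈t)

  inverse-unique : ∀ {x y z} → x * y ≈ 1# → x * z ≈ 1# → y ≈ z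
  inverse-unique {x} {y} {z} xy≈1 xz≈1 = begin
    y             ≈⟨ *-identityʳ y ⟨
    y * 1#        ≈⟨ *-congˡ xz≈1 ⟨
    y * (x * z)   ≈⟨ solve 3 (λ y x z → y :* (x :* z) := x :* y :* z) refl y x z ⟩
    (x * y) * z   ≈⟨ *-congʳ xy≈1 ⟩
    1# * z        ≈⟨ *-identityˡ z ⟩
    z             ∎

  *-cancelˡ-invertible : ∀ {c c′ x y} → c * c′ ≈ 1# → c * x ≈ c * y → x ≈ y
  *-cancelˡ-invertible {c} {c′} {x} {y} cc′≈1 cx≈cy = begin
    x               ≈⟨ *-identityˡ x ⟨
    1# * x          ≈⟨ *-congʳ cc′≈1 ⟨
    c * c′ * x      ≈⟨ lemma x ⟩
    c′ * (c * x)    ≈⟨ *-congˡ cx≈cy ⟩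
    c′ * (c * y)    ≈⟨ lemma y ⟨
    c * c′ * y      ≈⟨ *-congʳ cc′≈1 ⟩
    1# * y          ≈⟨ *-identityˡ y ⟩
    y               ∎
    where
    lemma : ∀ z → c * c′ * z ≈ c′ * (c * z)
    lemma = solve 3 (λ c c′ z → c :* c′ :* z := c′ :* (c :* z)) refl c c′

  isUnit-1 : IsUnit 1#
  isUnit-1 = In-1 , 1# , In-1 , *-identityˡ 1#

  isUnit-resp : ∀ {x y} → x ≈ y → IsUnit x → IsUnit y
  isUnit-resp x≈y (x∈R , x′ , x′∈R , xx′≈1) =
    In-resp x≈y x∈R , x′ , x′∈R , trans (*-congʳ (sym x≈y)) xx′≈1

  isUnit-* : ∀ {x y} → IsUnit x → IsUnit y → IsUnit (x * y)
  isUnit-* {x} {y} (x∈R , x′ , x′∈R , xx′≈1) (y∈R , y′ , y′∈R , yy′≈1) =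
    In-* x∈R y∈R , x′ * y′ , In-* x′∈R y′∈R , (begin
      (x * y) * (x′ * y′)   ≈⟨ solve 4 (λ x y x′ y′ → x :* y :* (x′ :* y′) := x :* x′ :* (y :* y′)) refl x y x′ y′ ⟩
      (x * x′) * (y * y′)   ≈⟨ *-cong xx′≈1 yy′≈1 ⟩
      1# * 1#               ≈⟨ *-identityˡ 1# ⟩
      1#                    ∎)

  isUnit-factorˡ : ∀ {x y} → In x → In y → IsUnit (x * y) → IsUnit x
  isUnit-factorˡ {x} {y} x∈R y∈R (_ , z , z∈R , xyz≈1) =
    x∈R , y * z , In-* y∈R z∈R , trans (sym (*-assoc x y z)) xyz≈1

  isUnit-factorʳ : ∀ {x y} → In x → In y → IsUnit (x * y) → IsUnit y
  isUnit-factorʳ {x} {y} x∈R y∈R xy-unit = isUnit-factorˡ y∈R x∈R (isUnit-resp (*-comm x y) xy-unit)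

  ≡1-mod : A → A → Set
  ≡1-mod π y = Σ A λ z → In z × (y ≈ 1# + π * z)

  ≡1-mod-cong : ∀ {π π′ y} → π ≈ π′ → ≡1-mod π y → ≡1-mod π′ y
  ≡1-mod-cong π≈π′ (z , z∈R , y≈) = z , z∈R , trans y≈ (+-congˡ (*-congʳ π≈π′))

  ≡1-mod-*ʳ : ∀ {π ε y} → In ε → ≡1-mod (π * ε) y → ≡1-mod π y
  ≡1-mod-*ʳ {π} {ε} {y} ε∈R (z , z∈R , y≈) = ε * z , In-* ε∈R z∈R ,
    trans y≈ (+-congˡ (solve 3 (λ π ε z → π :* ε :* z := π :* (ε :* z)) refl π ε z))

  ≡1-mod-unitʳ : ∀ {π ε y} → IsUnit ε → ≡1-mod π y → ≡1-mod (π * ε) y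
  ≡1-mod-unitʳ {π} {ε} {y} (_ , ε′ , ε′∈R , εε′≈1) (z , z∈R , y≈) = ε′ * z , In-* ε′∈R z∈R , (begin
    y                        ≈⟨ y≈ ⟩
    1# + π * z               ≈⟨ +-congˡ (*-congˡ (*-identityˡ z)) ⟨
    1# + π * (1# * z)        ≈⟨ +-congˡ (*-congˡ (*-congʳ εε′≈1)) ⟨
    1# + π * (ε * ε′ * z)    ≈⟨ +-congˡ (solve 4 (λ π ε ε′ z → π :* (ε :* ε′ :* z) := π :* ε :* (ε′ :* z)) refl π ε ε′ z) ⟩
    1# + π * ε * (ε′ * z)    ∎)

  ≡1-mod-unit : ∀ {π y} → IsUnit π → In y → ≡1-mod π y
  ≡1-mod-unit {π} {y} (_ , π′ , π′∈R , ππ′≈1) y∈R = π′ * (y - 1#) , In-* π′∈R (In-− y∈R In-1) , (begin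
    y                           ≈⟨ solve 2 (λ y o → y := o :+ (y :- o)) refl y 1# ⟩
    1# + (y - 1#)               ≈⟨ +-congˡ (*-identityˡ _) ⟨
    1# + 1# * (y - 1#)          ≈⟨ +-congˡ (*-congʳ ππ′≈1) ⟨
    1# + π * π′ * (y - 1#)      ≈⟨ +-congˡ (*-assoc π π′ _) ⟩
    1# + π * (π′ * (y - 1#))    ∎)

  module Inverse (inv : A → A) (inv-correct : ∀ {x} → IsUnit x → x * inv x ≈ 1#) where

    inverseˡ : ∀ {x} → IsUnit x → inv x * x ≈ 1#
    inverseˡ x-unit = trans (*-comm _ _) (inv-correct x-unit)

    inv-∈ : ∀ {x} → IsUnit x → In (inv x)
    inv-∈ x-unit@(_ , x′ , x′∈R , xx′≈1) = In-resp (inverse-unique xx′≈1 (inv-correct x-unit)) x′∈R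

    isUnit-inv : ∀ {x} → IsUnit x → IsUnit (inv x)
    isUnit-inv x-unit@(x∈R , _) = inv-∈ x-unit , _ , x∈R , inverseˡ x-unit

    inv-cong : ∀ {x y} → IsUnit x → x ≈ y → inv x ≈ inv y
    inv-cong x-unit x≈y =
      inverse-unique (inv-correct x-unit) (trans (*-congʳ x≈y) (inv-correct (isUnit-resp x≈y x-unit)))

    inv-1 : inv 1# ≈ 1#
    inv-1 = inverse-unique (inv-correct isUnit-1) (*-identityˡ 1#)

    inv-* : ∀ {x y} → IsUnit x → IsUnit y → inv (x * y) ≈ inv x * inv y
    inv-* {x} {y} x-unit y-unit = inverse-unique (inv-correct (isUnit-* x-unit y-unit)) (begin
      x * y * (inv x * inv y)       ≈⟨ solve 4 (λ x y x′ y′ → x :* y :* (x′ :* y′) := x :* x′ :* (y :* y′)) refl x y (inv x) (inv y) ⟩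
      x * inv x * (y * inv y)       ≈⟨ *-cong (inv-correct x-unit) (inv-correct y-unit) ⟩
      1# * 1#                       ≈⟨ *-identityˡ 1# ⟩
      1#                            ∎)

    fraction-resp-scaling : ∀ {c x x′ y y′} → IsUnit c → IsUnit y′ →
                            x ≈ c * x′ → y ≈ c * y′ → x * inv y ≈ x′ * inv y′
    fraction-resp-scaling {c} {x} {x′} {y} {y′} c-unit y′-unit x≈ y≈ = begin
      x * inv y                        ≈⟨ *-cong x≈ (inv-cong y-unit y≈) ⟩
      c * x′ * inv (c * y′)            ≈⟨ *-congˡ (inv-* c-unit y′-unit) ⟩
      c * x′ * (inv c * inv y′)        ≈⟨ solve 4 (λ c x c′ y → c :* x :* (c′ :* y) := c :* c′ :* (x :* y)) refl c x′ (inv c) (inv y′) ⟩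
      c * inv c * (x′ * inv y′)        ≈⟨ *-congʳ (inv-correct c-unit) ⟩
      1# * (x′ * inv y′)               ≈⟨ *-identityˡ _ ⟩
      x′ * inv y′                      ∎
      where y-unit = isUnit-resp (sym y≈) (isUnit-* c-unit y′-unit)

    fraction-injective : ∀ {x x′ y y′} → IsUnit y → IsUnit y′ → x * inv y ≈ x′ * inv y′ →
                         (x ≈ (y * inv y′) * x′) × (y ≈ (y * inv y′) * y′)
    fraction-injective {x} {x′} {y} {y′} y-unit y′-unit x/y≈x′/y′ =
      (begin
        x                         ≈⟨ *-identityʳ x ⟨
        x * 1#                    ≈⟨ *-congˡ (inverseˡ y-unit) ⟨
        x * (inv y * y)           ≈⟨ *-assoc x (inv y) y ⟨
        x * inv y * y             ≈⟨ *-congʳ x/y≈x′/y′ ⟩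
        x′ * inv y′ * y           ≈⟨ solve 3 (λ x′ y′ y → x′ :* y′ :* y := y :* y′ :* x′) refl x′ (inv y′) y ⟩
        y * inv y′ * x′           ∎) ,
      (begin
        y                         ≈⟨ *-identityʳ y ⟨
        y * 1#                    ≈⟨ *-congˡ (inverseˡ y′-unit) ⟨
        y * (inv y′ * y′)         ≈⟨ *-assoc y (inv y′) y′ ⟨
        y * inv y′ * y′           ∎)

    fraction-* : ∀ {x x′ y y′} → IsUnit y → IsUnit y′ →
                 (x * x′) * inv (y * y′) ≈ (x * inv y) * (x′ * inv y′)
    fraction-* {x} {x′} {y} {y′} y-unit y′-unit = begin
      x * x′ * inv (y * y′)            ≈⟨ *-congˡ (inv-* y-unit y′-unit) ⟩
      x * x′ * (inv y * inv y′)        ≈⟨ solve 4 (λ x x′ i i′ → x :* x′ :* (i :* i′) := x :* i :* (x′ :* i′)) refl x x′ (inv y) (inv y′) ⟩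
      x * inv y * (x′ * inv y′)        ∎

  module Sequences (P Q : A) (P∈R : In P) (Q-unit : IsUnit Q) where

    private
      Q∈R : In Q
      Q∈R = proj₁ Q-unit

      Q⁻¹ : A
      Q⁻¹ = proj₁ (proj₂ Q-unit)

      Q⁻¹∈R : In Q⁻¹
      Q⁻¹∈R = proj₁ (proj₂ (proj₂ Q-unit))

      QQ⁻¹≈1 : Q * Q⁻¹ ≈ 1#
      QQ⁻¹≈1 = proj₂ (proj₂ (proj₂ Q-unit))

    -- (wₙ , wₙ₊₁) and (w₋ₙ , w₁₋ₙ) for the sequence with w₁ = a, w₀ = b
    forward : A → A → ℕ → A × A
    forward a b zero    = b , a
    forward a b (suc n) = let (x , y) = forward a b n in y , P * y - Q * x

    backward : A → A → ℕ → A × A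
    backward a b zero    = b , a
    backward a b (suc n) = let (x , y) = backward a b n in Q⁻¹ * (P * x - y) , x

    terms : A → A → ℤ → A
    terms a b (+ n)    = proj₁ (forward a b n)
    terms a b -[1+ n ] = proj₁ (backward a b (suc n))

    private
      forward-step : ∀ x y → P * y - Q * x - P * y + Q * x ≈ 0#
      forward-step = solve 4 (λ p q x y → p :* y :- q :* x :- p :* y :+ q :* x := con (+ 0)) refl P Q

      backward-step : ∀ x y → y - P * x + Q * (Q⁻¹ * (P * x - y)) ≈ 0#
      backward-step x y = begin
        y - P * x + Q * (Q⁻¹ * (P * x - y))   ≈⟨ +-congˡ (*-assoc Q Q⁻¹ _) ⟨
        y - P * x + Q * Q⁻¹ * (P * x - y)     ≈⟨ +-congˡ (*-congʳ QQ⁻¹≈1) ⟩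
        y - P * x + 1# * (P * x - y)          ≈⟨ +-congˡ (*-identityˡ _) ⟩
        y - P * x + (P * x - y)               ≈⟨ solve 3 (λ p x y → y :- p :* x :+ (p :* x :- y) := con (+ 0)) refl P x y ⟩
        0#                                    ∎

    terms-rec : ∀ a b n → terms a b (n ℤ.+ + 2) - P * terms a b (n ℤ.+ + 1) + Q * terms a b n ≈ 0#
    -- the negative cases are split until n + 1 and n + 2 reduce
    terms-rec a b (+ m) rewrite ℕP.+-comm m 2 | ℕP.+-comm m 1 = forward-step _ _
    terms-rec a b -[1+ 0 ]           = backward-step _ _
    terms-rec a b -[1+ 1 ]           = backward-step _ _
    terms-rec a b -[1+ suc (suc k) ] = backward-step _ _

    terms-∈ : ∀ a b → In a → In b → ∀ n → In (terms a b n)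
    terms-∈ a b a∈R b∈R (+ n)    = proj₁ (forward-∈ n)
      where
      forward-∈ : ∀ n → In (proj₁ (forward a b n)) × In (proj₂ (forward a b n))
      forward-∈ zero    = b∈R , a∈R
      forward-∈ (suc n) = let (x∈R , y∈R) = forward-∈ n in y∈R , In-− (In-* P∈R y∈R) (In-* Q∈R x∈R)
    terms-∈ a b a∈R b∈R -[1+ n ] = proj₁ (backward-∈ (suc n))
      where
      backward-∈ : ∀ n → In (proj₁ (backward a b n)) × In (proj₂ (backward a b n))
      backward-∈ zero    = b∈R , a∈R
      backward-∈ (suc n) = let (x∈R , y∈R) = backward-∈ n in In-* Q⁻¹∈R (In-− (In-* P∈R x∈R) y∈R) , x∈R

    fromInitial : (w₁ w₀ : A) → In w₁ → In w₀ → IsUnit (Λ P Q w₁ w₀) → Seq 𝔸 P Q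
    fromInitial w₁ w₀ w₁∈R w₀∈R Λ-unit = record
      { w = terms w₁ w₀ ; inR = terms-∈ w₁ w₀ w₁∈R w₀∈R ; rec = terms-rec w₁ w₀ ; unitΛ = Λ-unit }

    recurrence-up : ∀ (u : Seq 𝔸 P Q) n → w u (n ℤ.+ + 2) ≈ P * w u (n ℤ.+ + 1) - Q * w u n
    recurrence-up u n = begin
      x                                 ≈⟨ solve 5 (λ p q x y z → x := x :- p :* y :+ q :* z :+ (p :* y :- q :* z)) refl P Q x y z ⟩
      (x - P * y + Q * z) + (P * y - Q * z) ≈⟨ +-congʳ (rec u n) ⟩
      0# + (P * y - Q * z)              ≈⟨ +-identityˡ _ ⟩
      P * y - Q * z                     ∎
      where
      x y z : A
      x = w u (n ℤ.+ + 2)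
      y = w u (n ℤ.+ + 1)
      z = w u n

    recurrence-down : ∀ (u : Seq 𝔸 P Q) n → Q * w u n ≈ P * w u (n ℤ.+ + 1) - w u (n ℤ.+ + 2)
    recurrence-down u n = begin
      Q * z                             ≈⟨ solve 5 (λ p q x y z → q :* z := x :- p :* y :+ q :* z :+ (p :* y :- x)) refl P Q x y z ⟩
      (x - P * y + Q * z) + (P * y - x) ≈⟨ +-congʳ (rec u n) ⟩
      0# + (P * y - x)                  ≈⟨ +-identityˡ _ ⟩
      P * y - x                         ∎
      where
      x y z : A
      x = w u (n ℤ.+ + 2)
      y = w u (n ℤ.+ + 1)
      z = w u n

    module _ (u v : Seq 𝔸 P Q) (c : A) where

      ScaledAt : ℤ → Set
      ScaledAt n = w u n ≈ c * w v n

      scaledAt-up : ∀ n → ScaledAt n → ScaledAt (n ℤ.+ + 1) → ScaledAt (n ℤ.+ + 2)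
      scaledAt-up n z≈ y≈ = begin
        w u (n ℤ.+ + 2)                             ≈⟨ recurrence-up u n ⟩
        P * w u (n ℤ.+ + 1) - Q * w u n             ≈⟨ -‿cong₂ (*-congˡ y≈) (*-congˡ z≈) ⟩
        P * (c * w v (n ℤ.+ + 1)) - Q * (c * w v n) ≈⟨ solve 5 (λ p q c y z → p :* (c :* y) :- q :* (c :* z) := c :* (p :* y :- q :* z)) refl P Q c _ _ ⟩
        c * (P * w v (n ℤ.+ + 1) - Q * w v n)       ≈⟨ *-congˡ (recurrence-up v n) ⟨
        c * w v (n ℤ.+ + 2)                         ∎

      scaledAt-down : ∀ n → ScaledAt (n ℤ.+ + 1) → ScaledAt (n ℤ.+ + 2) → ScaledAt n
      scaledAt-down n y≈ x≈ = *-cancelˡ-invertible QQ⁻¹≈1 (begin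
        Q * w u n                                   ≈⟨ recurrence-down u n ⟩
        P * w u (n ℤ.+ + 1) - w u (n ℤ.+ + 2)       ≈⟨ -‿cong₂ (*-congˡ y≈) x≈ ⟩
        P * (c * w v (n ℤ.+ + 1)) - c * w v (n ℤ.+ + 2) ≈⟨ solve 4 (λ p c y x → p :* (c :* y) :- c :* x := c :* (p :* y :- x)) refl P c _ _ ⟩
        c * (P * w v (n ℤ.+ + 1) - w v (n ℤ.+ + 2)) ≈⟨ *-congˡ (recurrence-down v n) ⟨
        c * (Q * w v n)                             ≈⟨ solve 3 (λ c q z → c :* (q :* z) := q :* (c :* z)) refl c Q _ ⟩
        Q * (c * w v n)                             ∎)

      scaledAt-all : ScaledAt (+ 0) → ScaledAt (+ 1) → ∀ n → ScaledAt n
      scaledAt-all s₀ s₁ (+ m)    = proj₁ (up m)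
        where
        up : ∀ m → ScaledAt (+ m) × ScaledAt (+ suc m)
        up zero    = s₀ , s₁
        up (suc m) = let (sₘ , sₘ₊₁) = up m in
          sₘ₊₁ , ≡.subst ScaledAt (≡.cong +_ (ℕP.+-comm m 2))
                   (scaledAt-up (+ m) sₘ (≡.subst ScaledAt (≡.cong +_ (ℕP.+-comm 1 m)) sₘ₊₁))
      scaledAt-all s₀ s₁ -[1+ m ] = proj₁ (down m)
        where
        down : ∀ m → ScaledAt -[1+ m ] × ScaledAt (-[1+ m ] ℤ.+ + 1)
        down zero    = scaledAt-down -[1+ 0 ] s₀ s₁ , s₀
        down (suc m) = let (s₋ₘ₋₁ , s₋ₘ) = down m in
          scaledAt-down -[1+ suc m ] s₋ₘ₋₁ (≡.subst ScaledAt (ℤP.+-assoc -[1+ suc m ] (+ 1) (+ 1)) s₋ₘ) , s₋ₘ₋₁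

    ∼-fromInitial : ∀ u v c → IsUnit c → w u (+ 1) ≈ c * w v (+ 1) → w u (+ 0) ≈ c * w v (+ 0) → _∼_ 𝔸 P Q u v
    ∼-fromInitial u v c c-unit s₁ s₀ = c , c-unit , scaledAt-all u v c s₀ s₁

    norm : A → A → A
    norm a b = a * a + P * a * b + Q * b * b

    norm-cong : ∀ {a a′ b b′} → a ≈ a′ → b ≈ b′ → norm a b ≈ norm a′ b′
    norm-cong a≈ b≈ = +-cong (+-cong (*-cong a≈ a≈) (*-cong (*-congˡ a≈) b≈)) (*-cong (*-congˡ b≈) b≈)

    norm-* : ∀ a b c d → norm a b * norm c d ≈ norm (a * c - Q * b * d) (a * d + b * c + P * b * d)
    norm-* = solve 6 (λ p q a b c d →
      (a :* a :+ p :* a :* b :+ q :* b :* b) :* (c :* c :+ p :* c :* d :+ q :* d :* d)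
        := (a :* c :- q :* b :* d) :* (a :* c :- q :* b :* d)
           :+ p :* (a :* c :- q :* b :* d) :* (a :* d :+ b :* c :+ p :* b :* d)
           :+ q :* (a :* d :+ b :* c :+ p :* b :* d) :* (a :* d :+ b :* c :+ p :* b :* d)) refl P Q

    norm-1 : norm 1# 0# ≈ 1#
    norm-1 = trans (solve 3 (λ p q o → o :* o :+ p :* o :* con (+ 0) :+ q :* con (+ 0) :* con (+ 0) := o :* o) refl P Q 1#)
                   (*-identityˡ 1#)

    norm-∈ : ∀ {a b} → In a → In b → In (norm a b)
    norm-∈ a∈R b∈R = In-+ (In-+ (In-* a∈R a∈R) (In-* (In-* P∈R a∈R) b∈R)) (In-* (In-* Q∈R b∈R) b∈R)

    Λ-neg≈norm : ∀ a b → Λ P Q a (- b) ≈ norm a b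
    Λ-neg≈norm = solve 4 (λ p q a b → a :* a :- p :* (:- b) :* a :+ q :* (:- b) :* (:- b)
                                         := a :* a :+ p :* a :* b :+ q :* b :* b) refl P Q

    norm-isUnit : ∀ {x} → IsUnitθ 𝔸 P Q x → IsUnit (norm (proj₁ x) (proj₂ x))
    norm-isUnit {a , b} (a∈R , b∈R , (c , d) , c∈R , d∈R , re≈1 , im≈0) =
      norm-∈ a∈R b∈R , norm c d , norm-∈ c∈R d∈R ,
      trans (norm-* a b c d) (trans (norm-cong re≈1 im≈0) norm-1)

    private
      _≈θ_ : A × A → A × A → Set
      _≈θ_ = Target._≈T_ (QuadModUnits 𝔸 P Q)

    -- (w₁ − w₀θ)⁻¹ = (w₁ − Pw₀ + w₀θ) Λ⁻¹
    quadMap-isUnitθ : ∀ u → IsUnitθ 𝔸 P Q (quadMap 𝔸 P Q u)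
    quadMap-isUnitθ u with unitΛ u
    ... | _ , Λ⁻¹ , Λ⁻¹∈R , ΛΛ⁻¹≈1 =
      w₁∈R , In-neg w₀∈R , ((w₁ - P * w₀) * Λ⁻¹ , w₀ * Λ⁻¹) ,
      In-* (In-− w₁∈R (In-* P∈R w₀∈R)) Λ⁻¹∈R , In-* w₀∈R Λ⁻¹∈R ,
      trans (solve 5 (λ p q a b l → a :* ((a :- p :* b) :* l) :- q :* (:- b) :* (b :* l)
                          := (a :* a :- p :* b :* a :+ q :* b :* b) :* l) refl P Q w₁ w₀ Λ⁻¹) ΛΛ⁻¹≈1 ,
      solve 4 (λ p a b l → a :* (b :* l) :+ (:- b) :* ((a :- p :* b) :* l) :+ p :* (:- b) :* (b :* l)
                  := con (+ 0)) refl P w₁ w₀ Λ⁻¹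
      where
      w₁ w₀ : A
      w₁ = w u (+ 1)
      w₀ = w u (+ 0)
      w₁∈R : In w₁
      w₁∈R = inR u (+ 1)
      w₀∈R : In w₀
      w₀∈R = inR u (+ 0)

    quadMap-resp : ∀ u v → _∼_ 𝔸 P Q u v → quadMap 𝔸 P Q u ≈θ quadMap 𝔸 P Q v
    quadMap-resp u v (c , c-unit , u≈cv) =
      c , c-unit , u≈cv (+ 1) , trans (-‿cong (u≈cv (+ 0))) (solve 2 (λ c x → :- (c :* x) := c :* (:- x)) refl c _)

    quadMap-injective : ∀ u v → quadMap 𝔸 P Q u ≈θ quadMap 𝔸 P Q v → _∼_ 𝔸 P Q u v
    quadMap-injective u v (c , c-unit , w₁≈ , -w₀≈) = ∼-fromInitial u v c c-unit w₁≈ (begin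
      w u (+ 0)           ≈⟨ solve 1 (λ x → x := :- (:- x)) refl _ ⟩
      - (- w u (+ 0))     ≈⟨ -‿cong -w₀≈ ⟩
      - (c * - w v (+ 0)) ≈⟨ solve 2 (λ c x → :- (c :* (:- x)) := c :* x) refl c _ ⟩
      c * w v (+ 0)       ∎)

    quadMap-surjective : ∀ x → IsUnitθ 𝔸 P Q x → Σ (Seq 𝔸 P Q) (λ u → quadMap 𝔸 P Q u ≈θ x)
    quadMap-surjective (a , b) x-unit@(a∈R , b∈R , _) =
      fromInitial a (- b) a∈R (In-neg b∈R) (isUnit-resp (sym (Λ-neg≈norm a b)) (norm-isUnit x-unit)) ,
      1# , isUnit-1 , sym (*-identityˡ a) , trans (solve 1 (λ x → :- (:- x) := x) refl b) (sym (*-identityˡ b))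

    quadMap-hom : ∀ u v r → IsProd 𝔸 P Q u v r →
                  quadMap 𝔸 P Q r ≈θ _·θ_ 𝔸 P Q (quadMap 𝔸 P Q u) (quadMap 𝔸 P Q v)
    quadMap-hom u v r (r₁≈ , r₀≈) = 1# , isUnit-1 ,
      trans r₁≈ (trans (solve 5 (λ q a b c d → a :* c :- q :* b :* d := a :* c :- q :* (:- b) :* (:- d)) refl Q _ _ _ _)
                       (sym (*-identityˡ _))) ,
      trans (-‿cong r₀≈) (trans (solve 5 (λ p a b c d → :- (b :* c :+ a :* d :- p :* b :* d)
                                             := a :* (:- d) :+ (:- b) :* c :+ p :* (:- b) :* (:- d)) refl P _ _ _ _)
                                (sym (*-identityˡ _)))

    quadMap-isIso : IsIso 𝔸 P Q (QuadModUnits 𝔸 P Q) (quadMap 𝔸 P Q)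
    quadMap-isIso = record
      { into = quadMap-isUnitθ ; resp = quadMap-resp ; inj = quadMap-injective
      ; surj = quadMap-surjective ; hom = quadMap-hom }

    rootForm : A → Seq 𝔸 P Q → A
    rootForm t u = w u (+ 1) - w u (+ 0) * t

    rootForm-∈ : ∀ {t} → In t → ∀ u → In (rootForm t u)
    rootForm-∈ t∈R u = In-− (inR u (+ 1)) (In-* (inR u (+ 0)) t∈R)

    rootForm-scaled : ∀ {c} u v t → (∀ n → w u n ≈ c * w v n) → rootForm t u ≈ c * rootForm t v
    rootForm-scaled {c} u v t u≈cv = trans (-‿cong₂ (u≈cv (+ 1)) (*-congʳ (u≈cv (+ 0))))
      (solve 4 (λ c a b t → c :* a :- c :* b :* t := c :* (a :- b :* t)) refl c (w v (+ 1)) (w v (+ 0)) t)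

    w₁-scaled : ∀ {c} u v t → w u (+ 0) ≈ c * w v (+ 0) → rootForm t u ≈ c * rootForm t v →
                w u (+ 1) ≈ c * w v (+ 1)
    w₁-scaled {c} u v t w₀≈ rootForm≈ = begin
      w u (+ 1)                          ≈⟨ w₁≈ u ⟩
      rootForm t u + w u (+ 0) * t       ≈⟨ +-cong rootForm≈ (*-congʳ w₀≈) ⟩
      c * rootForm t v + c * w v (+ 0) * t ≈⟨ solve 4 (λ c x b t → c :* x :+ c :* b :* t := c :* (x :+ b :* t)) refl c (rootForm t v) (w v (+ 0)) t ⟩
      c * (rootForm t v + w v (+ 0) * t) ≈⟨ *-congˡ (w₁≈ v) ⟨
      c * w v (+ 1)                      ∎
      where
      w₁≈ : ∀ s → w s (+ 1) ≈ rootForm t s + w s (+ 0) * t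
      w₁≈ s = solve 3 (λ a b t → a := a :- b :* t :+ b :* t) refl (w s (+ 1)) (w s (+ 0)) t

    rootForm-* : ∀ t → t * t ≈ P * t - Q → ∀ u v r → IsProd 𝔸 P Q u v r →
                 rootForm t r ≈ rootForm t u * rootForm t v
    rootForm-* t t-root u v r (r₁≈ , r₀≈) = begin
      rootForm t r                                            ≈⟨ -‿cong₂ r₁≈ (*-congʳ r₀≈) ⟩
      (u₁ * v₁ - Q * u₀ * v₀) - (u₀ * v₁ + u₁ * v₀ - P * u₀ * v₀) * t
        ≈⟨ solve 7 (λ p q t u₁ u₀ v₁ v₀ → (u₁ :* v₁ :- q :* u₀ :* v₀) :- (u₀ :* v₁ :+ u₁ :* v₀ :- p :* u₀ :* v₀) :* t
                      := u₁ :* v₁ :- t :* (u₀ :* v₁ :+ u₁ :* v₀) :+ (p :* t :- q) :* (u₀ :* v₀)) refl P Q t u₁ u₀ v₁ v₀ ⟩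
      u₁ * v₁ - t * (u₀ * v₁ + u₁ * v₀) + (P * t - Q) * (u₀ * v₀) ≈⟨ +-congˡ (*-congʳ t-root) ⟨
      u₁ * v₁ - t * (u₀ * v₁ + u₁ * v₀) + (t * t) * (u₀ * v₀)
        ≈⟨ solve 5 (λ t u₁ u₀ v₁ v₀ → u₁ :* v₁ :- t :* (u₀ :* v₁ :+ u₁ :* v₀) :+ (t :* t) :* (u₀ :* v₀)
                      := (u₁ :- u₀ :* t) :* (v₁ :- v₀ :* t)) refl t u₁ u₀ v₁ v₀ ⟩
      rootForm t u * rootForm t v                             ∎
      where
      u₁ u₀ v₁ v₀ : A
      u₁ = w u (+ 1)
      u₀ = w u (+ 0)
      v₁ = w v (+ 1)
      v₀ = w v (+ 0)

    module Split (inv : A → A) (inv-correct : ∀ {x} → IsUnit x → x * inv x ≈ 1#)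
                 (θ₁ θ₂ : A) (θ₁∈R : In θ₁) (θ₂∈R : In θ₂) (P≈ : P ≈ θ₁ + θ₂) (Q≈ : Q ≈ θ₁ * θ₂)
                 (δ⁻¹ : A) (δδ⁻¹≈1 : (θ₁ - θ₂) * δ⁻¹ ≈ 1#) where
      open Inverse inv inv-correct

      δ : A
      δ = θ₁ - θ₂

      ratio : Seq 𝔸 P Q → A
      ratio = ratioMap 𝔸 P Q inv θ₁ θ₂

      Λ-factor : ∀ a b → Λ P Q a b ≈ (a - b * θ₁) * (a - b * θ₂)
      Λ-factor a b = begin
        Λ P Q a b                                   ≈⟨ +-cong (-‿cong₂ refl (*-congʳ (*-congʳ P≈))) (*-congʳ (*-congʳ Q≈)) ⟩
        a * a - (θ₁ + θ₂) * b * a + θ₁ * θ₂ * b * b ≈⟨ solve 4 (λ t s a b → a :* a :- (t :+ s) :* b :* a :+ t :* s :* b :* b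
                                                                  := (a :- b :* t) :* (a :- b :* s)) refl θ₁ θ₂ a b ⟩
        (a - b * θ₁) * (a - b * θ₂)                 ∎

      rootForms-isUnit : ∀ u → IsUnit (rootForm θ₁ u) × IsUnit (rootForm θ₂ u)
      rootForms-isUnit u = isUnit-factorˡ X∈R Y∈R XY-unit , isUnit-factorʳ X∈R Y∈R XY-unit
        where
        X∈R : In (rootForm θ₁ u)
        X∈R = rootForm-∈ θ₁∈R u
        Y∈R : In (rootForm θ₂ u)
        Y∈R = rootForm-∈ θ₂∈R u
        XY-unit : IsUnit (rootForm θ₁ u * rootForm θ₂ u)
        XY-unit = isUnit-resp (Λ-factor _ _) (unitΛ u)

      θ₁-root : θ₁ * θ₁ ≈ P * θ₁ - Q
      θ₁-root = sym (trans (-‿cong₂ (*-congʳ P≈) Q≈)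
                       (solve 2 (λ t s → (t :+ s) :* t :- t :* s := t :* t) refl θ₁ θ₂))

      θ₂-root : θ₂ * θ₂ ≈ P * θ₂ - Q
      θ₂-root = sym (trans (-‿cong₂ (*-congʳ P≈) Q≈)
                       (solve 2 (λ t s → (t :+ s) :* s :- t :* s := s :* s) refl θ₁ θ₂))

      ratio-resp : ∀ u v → _∼_ 𝔸 P Q u v → ratio u ≈ ratio v
      ratio-resp u v (c , c-unit , u≈cv) = fraction-resp-scaling c-unit (proj₂ (rootForms-isUnit v))
        (rootForm-scaled u v θ₁ u≈cv) (rootForm-scaled u v θ₂ u≈cv)

      w₀≈ : ∀ u → w u (+ 0) ≈ (rootForm θ₂ u - rootForm θ₁ u) * δ⁻¹
      w₀≈ u = begin
        w u (+ 0)                               ≈⟨ *-identityʳ _ ⟨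
        w u (+ 0) * 1#                          ≈⟨ *-congˡ δδ⁻¹≈1 ⟨
        w u (+ 0) * (δ * δ⁻¹)                   ≈⟨ solve 5 (λ a b t s i → b :* ((t :- s) :* i) := (a :- b :* s :- (a :- b :* t)) :* i)
                                                     refl (w u (+ 1)) (w u (+ 0)) θ₁ θ₂ δ⁻¹ ⟩
        (rootForm θ₂ u - rootForm θ₁ u) * δ⁻¹   ∎

      ratio-injective : ∀ u v → ratio u ≈ ratio v → _∼_ 𝔸 P Q u v
      ratio-injective u v ratio≈ =
        ∼-fromInitial u v c (isUnit-* Yu-unit (isUnit-inv Yv-unit)) (w₁-scaled u v θ₁ w₀-scaled X≈) w₀-scaled
        where
        Yu-unit : IsUnit (rootForm θ₂ u)
        Yu-unit = proj₂ (rootForms-isUnit u)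
        Yv-unit : IsUnit (rootForm θ₂ v)
        Yv-unit = proj₂ (rootForms-isUnit v)
        c : A
        c = rootForm θ₂ u * inv (rootForm θ₂ v)
        X≈ : rootForm θ₁ u ≈ c * rootForm θ₁ v
        X≈ = proj₁ (fraction-injective Yu-unit Yv-unit ratio≈)
        Y≈ : rootForm θ₂ u ≈ c * rootForm θ₂ v
        Y≈ = proj₂ (fraction-injective Yu-unit Yv-unit ratio≈)
        w₀-scaled : w u (+ 0) ≈ c * w v (+ 0)
        w₀-scaled = begin
          w u (+ 0)                                         ≈⟨ w₀≈ u ⟩
          (rootForm θ₂ u - rootForm θ₁ u) * δ⁻¹             ≈⟨ *-congʳ (-‿cong₂ Y≈ X≈) ⟩
          (c * rootForm θ₂ v - c * rootForm θ₁ v) * δ⁻¹     ≈⟨ solve 4 (λ c y x i → (c :* y :- c :* x) :* i := c :* ((y :- x) :* i)) refl c _ _ δ⁻¹ ⟩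
          c * ((rootForm θ₂ v - rootForm θ₁ v) * δ⁻¹)       ≈⟨ *-congˡ (w₀≈ v) ⟨
          c * w v (+ 0)                                     ∎

      ratio-hom : ∀ u v r → IsProd 𝔸 P Q u v r → ratio r ≈ ratio u * ratio v
      ratio-hom u v r r≈uv = begin
        rootForm θ₁ r * inv (rootForm θ₂ r)
          ≈⟨ *-cong (rootForm-* θ₁ θ₁-root u v r r≈uv)
                    (inv-cong (proj₂ (rootForms-isUnit r)) (rootForm-* θ₂ θ₂-root u v r r≈uv)) ⟩
        (rootForm θ₁ u * rootForm θ₁ v) * inv (rootForm θ₂ u * rootForm θ₂ v)
          ≈⟨ fraction-* (proj₂ (rootForms-isUnit u)) (proj₂ (rootForms-isUnit v)) ⟩
        ratio u * ratio v ∎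

      -- w₁ − w₀θ₁ = (w₁ − w₀θ₂) − w₀δ
      ratio-≡1-mod-δ : ∀ u → ≡1-mod δ (ratio u)
      ratio-≡1-mod-δ u = - (w u (+ 0) * inv Y) , In-neg (In-* (inR u (+ 0)) (inv-∈ Y-unit)) , (begin
        rootForm θ₁ u * inv Y                      ≈⟨ solve 5 (λ a b t s i → (a :- b :* t) :* i := (a :- b :* s) :* i :+ (t :- s) :* (:- (b :* i)))
                                                        refl (w u (+ 1)) (w u (+ 0)) θ₁ θ₂ (inv Y) ⟩
        Y * inv Y + δ * - (w u (+ 0) * inv Y)      ≈⟨ +-congʳ (inv-correct Y-unit) ⟩
        1# + δ * - (w u (+ 0) * inv Y)             ∎)
        where
        Y : A
        Y = rootForm θ₂ u
        Y-unit : IsUnit Y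
        Y-unit = proj₂ (rootForms-isUnit u)

      -- the sequence with w₁ = 1 − zθ₂, w₀ = −z has w₁ − w₀θ₂ = 1 and w₁ − w₀θ₁ = 1 + δz
      ratio-surjective : ∀ y → IsUnit y → ≡1-mod δ y → Σ (Seq 𝔸 P Q) (λ u → ratio u ≈ y)
      ratio-surjective y y-unit (z , z∈R , y≈) = u , (begin
        rootForm θ₁ u * inv (rootForm θ₂ u)   ≈⟨ *-cong X≈y (inv-cong (proj₂ (rootForms-isUnit u)) Y≈1) ⟩
        y * inv 1#                            ≈⟨ *-congˡ inv-1 ⟩
        y * 1#                                ≈⟨ *-identityʳ y ⟩
        y                                     ∎)
        where
        w₁ w₀ : A
        w₁ = 1# - z * θ₂
        w₀ = - z
        Y≈1 : w₁ - w₀ * θ₂ ≈ 1#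
        Y≈1 = solve 3 (λ o z s → o :- z :* s :- (:- z) :* s := o) refl 1# z θ₂
        X≈y : w₁ - w₀ * θ₁ ≈ y
        X≈y = trans (solve 4 (λ o z t s → o :- z :* s :- (:- z) :* t := o :+ (t :- s) :* z) refl 1# z θ₁ θ₂) (sym y≈)
        Λ-unit : IsUnit (Λ P Q w₁ w₀)
        Λ-unit = isUnit-resp (sym (trans (Λ-factor w₁ w₀) (*-cong X≈y Y≈1))) (isUnit-* y-unit isUnit-1)
        u : Seq 𝔸 P Q
        u = fromInitial w₁ w₀ (In-− In-1 (In-* z∈R θ₂∈R)) (In-neg z∈R) Λ-unit

      ratio-isIso : (E : A → Set) → (∀ u → E (ratio u)) → (∀ {y} → E y → IsUnit y × ≡1-mod δ y) →
                    IsIso 𝔸 P Q (MulGroup 𝔸 P Q E) ratio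
      ratio-isIso E into E⊆ = record
        { into = into ; resp = ratio-resp ; inj = ratio-injective ; hom = ratio-hom
        ; surj = λ y y∈E → ratio-surjective y (proj₁ (E⊆ y∈E)) (proj₂ (E⊆ y∈E)) }

      ratio-isIso-units : In δ⁻¹ → IsIso 𝔸 P Q (MulGroup 𝔸 P Q IsUnit) ratio
      ratio-isIso-units δ⁻¹∈R = ratio-isIso IsUnit
        (λ u → isUnit-* (proj₁ (rootForms-isUnit u)) (isUnit-inv (proj₂ (rootForms-isUnit u))))
        (λ y-unit → y-unit , ≡1-mod-unit δ-unit (proj₁ y-unit))
        where δ-unit = In-− θ₁∈R θ₂∈R , δ⁻¹ , δ⁻¹∈R , δδ⁻¹≈1

      ratio-isIso-≡1-mod : ∀ {π ε} → δ ≈ π * ε → IsUnit ε → (∀ {y} → ≡1-mod π y → IsUnit y) →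
                           IsIso 𝔸 P Q (MulGroup 𝔸 P Q (≡1-mod π)) ratio
      ratio-isIso-≡1-mod δ≈πε ε-unit ≡1⇒unit = ratio-isIso (≡1-mod _)
        (λ u → ≡1-mod-*ʳ (proj₁ ε-unit) (≡1-mod-cong δ≈πε (ratio-≡1-mod-δ u)))
        (λ y≡1 → ≡1⇒unit y≡1 , ≡1-mod-cong (sym δ≈πε) (≡1-mod-unitʳ ε-unit y≡1))

    module DoubleRoot (inv : A → A) (inv-correct : ∀ {x} → IsUnit x → x * inv x ≈ 1#)
                      (θ : A) (θ∈R : In θ) (P≈ : P ≈ θ + θ) (Q≈ : Q ≈ θ * θ) where
      open Inverse inv inv-correct

      additive : Seq 𝔸 P Q → A
      additive = additiveMap 𝔸 P Q inv θ

      Λ-square : ∀ a b → Λ P Q a b ≈ (a - b * θ) * (a - b * θ)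
      Λ-square a b = begin
        Λ P Q a b                                ≈⟨ +-cong (-‿cong₂ refl (*-congʳ (*-congʳ P≈))) (*-congʳ (*-congʳ Q≈)) ⟩
        a * a - (θ + θ) * b * a + θ * θ * b * b  ≈⟨ solve 3 (λ t a b → a :* a :- (t :+ t) :* b :* a :+ t :* t :* b :* b
                                                               := (a :- b :* t) :* (a :- b :* t)) refl θ a b ⟩
        (a - b * θ) * (a - b * θ)                ∎

      θ-root : θ * θ ≈ P * θ - Q
      θ-root = sym (trans (-‿cong₂ (*-congʳ P≈) Q≈) (solve 1 (λ t → (t :+ t) :* t :- t :* t := t :* t) refl θ))

      rootForm-isUnit : ∀ u → IsUnit (rootForm θ u)
      rootForm-isUnit u = isUnit-factorˡ X∈R X∈R (isUnit-resp (Λ-square _ _) (unitΛ u))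
        where X∈R = rootForm-∈ θ∈R u

      additive-resp : ∀ u v → _∼_ 𝔸 P Q u v → additive u ≈ additive v
      additive-resp u v (c , c-unit , u≈cv) = fraction-resp-scaling c-unit (rootForm-isUnit v)
        (trans (-‿cong (u≈cv (+ 0))) (solve 2 (λ c x → :- (c :* x) := c :* (:- x)) refl c (w v (+ 0))))
        (rootForm-scaled u v θ u≈cv)

      additive-injective : ∀ u v → additive u ≈ additive v → _∼_ 𝔸 P Q u v
      additive-injective u v additive≈ =
        ∼-fromInitial u v c (isUnit-* (rootForm-isUnit u) (isUnit-inv (rootForm-isUnit v)))
          (w₁-scaled u v θ w₀-scaled X≈) w₀-scaled
        where
        c : A
        c = rootForm θ u * inv (rootForm θ v)
        -w₀≈ : - w u (+ 0) ≈ c * - w v (+ 0)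
        -w₀≈ = proj₁ (fraction-injective (rootForm-isUnit u) (rootForm-isUnit v) additive≈)
        X≈ : rootForm θ u ≈ c * rootForm θ v
        X≈ = proj₂ (fraction-injective (rootForm-isUnit u) (rootForm-isUnit v) additive≈)
        w₀-scaled : w u (+ 0) ≈ c * w v (+ 0)
        w₀-scaled = begin
          w u (+ 0)           ≈⟨ solve 1 (λ x → x := :- (:- x)) refl _ ⟩
          - (- w u (+ 0))     ≈⟨ -‿cong -w₀≈ ⟩
          - (c * - w v (+ 0)) ≈⟨ solve 2 (λ c x → :- (c :* (:- x)) := c :* x) refl c _ ⟩
          c * w v (+ 0)       ∎

      additive-hom : ∀ u v r → IsProd 𝔸 P Q u v r → additive r ≈ additive u + additive v
      additive-hom u v r r≈uv@(_ , r₀≈) = begin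
        (- w r (+ 0)) * inv (rootForm θ r)
          ≈⟨ *-cong (-‿cong r₀≈′) (inv-cong (rootForm-isUnit r) (rootForm-* θ θ-root u v r r≈uv)) ⟩
        (- (u₀ * X v + v₀ * X u)) * inv (X u * X v)
          ≈⟨ *-congˡ (inv-* (rootForm-isUnit u) (rootForm-isUnit v)) ⟩
        (- (u₀ * X v + v₀ * X u)) * (inv (X u) * inv (X v))
          ≈⟨ solve 6 (λ a b x y i j → (:- (a :* y :+ b :* x)) :* (i :* j) := (:- a) :* i :* (y :* j) :+ (:- b) :* j :* (x :* i))
                     refl u₀ v₀ (X u) (X v) (inv (X u)) (inv (X v)) ⟩
        additive u * (X v * inv (X v)) + additive v * (X u * inv (X u))
          ≈⟨ +-cong (*-congˡ (inv-correct (rootForm-isUnit v))) (*-congˡ (inv-correct (rootForm-isUnit u))) ⟩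
        additive u * 1# + additive v * 1#
          ≈⟨ +-cong (*-identityʳ _) (*-identityʳ _) ⟩
        additive u + additive v ∎
        where
        X : Seq 𝔸 P Q → A
        X = rootForm θ
        u₀ v₀ : A
        u₀ = w u (+ 0)
        v₀ = w v (+ 0)
        r₀≈′ : w r (+ 0) ≈ u₀ * X v + v₀ * X u
        r₀≈′ = trans r₀≈ (trans (+-congˡ (-‿cong (*-congʳ (*-congʳ P≈))))
          (solve 5 (λ t u₁ u₀ v₁ v₀ → u₀ :* v₁ :+ u₁ :* v₀ :- (t :+ t) :* u₀ :* v₀ := u₀ :* (v₁ :- v₀ :* t) :+ v₀ :* (u₁ :- u₀ :* t))
                 refl θ (w u (+ 1)) u₀ (w v (+ 1)) v₀))

      additive-surjective : ∀ y → In y → Σ (Seq 𝔸 P Q) (λ u → additive u ≈ y)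
      additive-surjective y y∈R = u , (begin
        (- (- y)) * inv (rootForm θ u)  ≈⟨ *-cong (solve 1 (λ y → :- (:- y) := y) refl y) (inv-cong (rootForm-isUnit u) X≈1) ⟩
        y * inv 1#                      ≈⟨ *-congˡ inv-1 ⟩
        y * 1#                          ≈⟨ *-identityʳ y ⟩
        y                               ∎)
        where
        w₁ w₀ : A
        w₁ = 1# - y * θ
        w₀ = - y
        X≈1 : w₁ - w₀ * θ ≈ 1#
        X≈1 = solve 3 (λ o y t → o :- y :* t :- (:- y) :* t := o) refl 1# y θ
        Λ-unit : IsUnit (Λ P Q w₁ w₀)
        Λ-unit = isUnit-resp (sym (trans (Λ-square w₁ w₀) (*-cong X≈1 X≈1))) (isUnit-* isUnit-1 isUnit-1)
        u : Seq 𝔸 P Q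
        u = fromInitial w₁ w₀ (In-− In-1 (In-* y∈R θ∈R)) (In-neg y∈R) Λ-unit

      additive-isIso : IsIso 𝔸 P Q (AddGroup 𝔸 P Q) additive
      additive-isIso = record
        { into = λ u → In-* (In-neg (inR u (+ 0))) (inv-∈ (rootForm-isUnit u))
        ; resp = additive-resp ; inj = additive-injective ; surj = additive-surjective ; hom = additive-hom }

prime⇒≡2+ : ∀ {p} → Prime p → Σ ℕ λ m → p ≡ suc (suc m)
prime⇒≡2+ {zero}        p-prime = ⊥-elim (¬prime[0] p-prime)
prime⇒≡2+ {suc zero}    p-prime = ⊥-elim (¬prime[1] p-prime)
prime⇒≡2+ {suc (suc m)} _       = m , ≡.refl

module PrimeDivisibility {p : ℕ} (p-prime : Prime p) where

  p∤1 : ¬ p ℕD.∣ 1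
  p∤1 p∣1 = ¬prime[1] (≡.subst Prime (ℕD.∣1⇒≡1 p∣1) p-prime)

  p∤* : ∀ {m n} → ¬ p ℕD.∣ m → ¬ p ℕD.∣ n → ¬ p ℕD.∣ m ℕ.* n
  p∤* {m} {n} p∤m p∤n p∣mn with euclidsLemma m n p-prime p∣mn
  ... | inj₁ p∣m = p∤m p∣m
  ... | inj₂ p∣n = p∤n p∣n

  ∣-euclid : ∀ i j → (+ p) ℤS.∣ (i ℤ.* j) → (+ p) ℤS.∣ i ⊎ (+ p) ℤS.∣ j
  ∣-euclid i j p∣ij with euclidsLemma ∣ i ∣ ∣ j ∣ p-prime (≡.subst (p ℕD.∣_) (ℤP.abs-* i j) (ℤS.∣⇒∣ᵤ p∣ij))
  ... | inj₁ p∣i = inj₁ (ℤS.∣ᵤ⇒∣ p∣i)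
  ... | inj₂ p∣j = inj₂ (ℤS.∣ᵤ⇒∣ p∣j)

  p∣square⇒p∣ : ∀ i → (+ p) ℤS.∣ (i ℤ.* i) → (+ p) ℤS.∣ i
  p∣square⇒p∣ i p∣ii with ∣-euclid i i p∣ii
  ... | inj₁ p∣i = p∣i
  ... | inj₂ p∣i = p∣i

  private
    instance
      p≢0 : ℕ.NonZero p
      p≢0 = prime⇒nonZero p-prime

    p*-cancel : ∀ {i j} → + p ℤ.* i ≡ + p ℤ.* j → i ≡ j
    p*-cancel {i} {j} = ℤP.*-cancelˡ-≡ (+ p) i j

    p^[1+s]* : ∀ s i → + (p ℕ.^ suc s) ℤ.* i ≡ + p ℤ.* (+ (p ℕ.^ s) ℤ.* i)
    p^[1+s]* s i = ≡.trans (≡.cong (ℤ._* i) (ℤP.pos-* p (p ℕ.^ s))) (ℤP.*-assoc (+ p) _ i)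

    [dq]²≡q[q[d²]] : ∀ d q → (d ℤ.* q) ℤ.* (d ℤ.* q) ≡ q ℤ.* (q ℤ.* (d ℤ.* d))
    [dq]²≡q[q[d²]] = solve-∀

  square-valuation : ∀ s δ D₀ → δ ℤ.* δ ≡ + (p ℕ.^ s) ℤ.* D₀ → ¬ (+ p) ℤS.∣ D₀ →
                     Σ ℕ λ k → Σ ℤ λ e → (s ≡ k ℕ.+ k) × (δ ≡ + (p ℕ.^ k) ℤ.* e) × ¬ (+ p) ℤS.∣ e
  square-valuation zero δ D₀ δ²≡D₀ p∤D₀ =
    0 , δ , ≡.refl , ≡.sym (ℤP.*-identityˡ δ) ,
    λ p∣δ → p∤D₀ (≡.subst ((+ p) ℤS.∣_) (≡.trans δ²≡D₀ (ℤP.*-identityˡ D₀)) (ℤS.∣m⇒∣m*n δ p∣δ))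
  square-valuation (suc s) δ D₀ δ²≡ p∤D₀ with p∣square⇒p∣ δ p∣δ²
    where
    p∣δ² : (+ p) ℤS.∣ (δ ℤ.* δ)
    p∣δ² = ≡.subst ((+ p) ℤS.∣_) (≡.sym (≡.trans δ²≡ (p^[1+s]* s D₀))) (ℤS.∣m⇒∣m*n _ ℤS.∣-refl)
  ... | ℤS.divides d ≡.refl = descend s p[d²]≡pˢD₀
    where
    p[d²]≡pˢD₀ : + p ℤ.* (d ℤ.* d) ≡ + (p ℕ.^ s) ℤ.* D₀
    p[d²]≡pˢD₀ = p*-cancel (≡.trans (≡.sym ([dq]²≡q[q[d²]] d (+ p)))
      (≡.trans δ²≡ (p^[1+s]* s D₀)))
    descend : ∀ s → + p ℤ.* (d ℤ.* d) ≡ + (p ℕ.^ s) ℤ.* D₀ →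
              Σ ℕ λ k → Σ ℤ λ e → (suc s ≡ k ℕ.+ k) × (d ℤ.* + p ≡ + (p ℕ.^ k) ℤ.* e) × ¬ (+ p) ℤS.∣ e
    descend zero    p[d²]≡D₀ = ⊥-elim (p∤D₀ (≡.subst ((+ p) ℤS.∣_) (≡.trans p[d²]≡D₀ (ℤP.*-identityˡ D₀))
                                                 (ℤS.∣m⇒∣m*n (d ℤ.* d) ℤS.∣-refl)))
    descend (suc s) p[d²]≡ with square-valuation s d D₀ d²≡ p∤D₀
      where
      d²≡ : d ℤ.* d ≡ + (p ℕ.^ s) ℤ.* D₀
      d²≡ = p*-cancel (≡.trans p[d²]≡ (p^[1+s]* s D₀))
    ... | k , e , s≡k+k , d≡pᵏe , p∤e = suc k , e ,
      ≡.cong suc (≡.trans (≡.cong suc s≡k+k) (≡.sym (ℕP.+-suc k k))) ,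
      ≡.trans (≡.cong (ℤ._* + p) d≡pᵏe) (≡.trans (lemma (+ (p ℕ.^ k)) e (+ p)) (≡.cong (ℤ._* e) (≡.sym (ℤP.pos-* p (p ℕ.^ k))))) ,
      p∤e
      where
      lemma : ∀ a e q → a ℤ.* e ℤ.* q ≡ q ℤ.* a ℤ.* e
      lemma = solve-∀

module CongruenceModulo (p : ℕ) where

  infix 4 _≈_
  _≈_ : ℤ → ℤ → Set
  x ≈ y = x ≡ y [mod p ]

  ≈⇒∣ : ∀ x y → x ≈ y → (+ p) ℤS.∣ (x ℤ.- y)
  ≈⇒∣ x y = ℤS.∣ᵤ⇒∣ {+ p} {x ℤ.- y}

  ∣⇒≈ : ∀ x y {d} → d ≡ x ℤ.- y → (+ p) ℤS.∣ d → x ≈ y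
  ∣⇒≈ x y ≡.refl = ℤS.∣⇒∣ᵤ {+ p} {x ℤ.- y}

  ≈-reflexive : ∀ {x y} → x ≡ y → x ≈ y
  ≈-reflexive {x} ≡.refl = ∣⇒≈ x x (≡.sym (ℤP.+-inverseʳ x)) (ℤS.∣ᵤ⇒∣ (p ℕD.∣0))

  ≈-sym : ∀ {x y} → x ≈ y → y ≈ x
  ≈-sym {x} {y} x≈y = ∣⇒≈ y x (lemma x y) (ℤS.∣m⇒∣-m (≈⇒∣ x y x≈y))
    where
    lemma : ∀ x y → ℤ.- (x ℤ.- y) ≡ y ℤ.- x
    lemma = solve-∀

  ≈-trans : ∀ {x y z} → x ≈ y → y ≈ z → x ≈ z
  ≈-trans {x} {y} {z} x≈y y≈z = ∣⇒≈ x z (lemma x y z) (ℤS.∣m∣n⇒∣m+n (≈⇒∣ x y x≈y) (≈⇒∣ y z y≈z))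
    where
    lemma : ∀ x y z → (x ℤ.- y) ℤ.+ (y ℤ.- z) ≡ x ℤ.- z
    lemma = solve-∀

  +-cong : ∀ {x x′ y y′} → x ≈ x′ → y ≈ y′ → x ℤ.+ y ≈ x′ ℤ.+ y′
  +-cong {x} {x′} {y} {y′} x≈ y≈ =
    ∣⇒≈ (x ℤ.+ y) (x′ ℤ.+ y′) (lemma x x′ y y′) (ℤS.∣m∣n⇒∣m+n (≈⇒∣ x x′ x≈) (≈⇒∣ y y′ y≈))
    where
    lemma : ∀ x x′ y y′ → (x ℤ.- x′) ℤ.+ (y ℤ.- y′) ≡ (x ℤ.+ y) ℤ.- (x′ ℤ.+ y′)
    lemma = solve-∀

  *-cong : ∀ {x x′ y y′} → x ≈ x′ → y ≈ y′ → x ℤ.* y ≈ x′ ℤ.* y′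
  *-cong {x} {x′} {y} {y′} x≈ y≈ = ∣⇒≈ (x ℤ.* y) (x′ ℤ.* y′) (lemma x x′ y y′)
    (ℤS.∣m∣n⇒∣m+n (ℤS.∣n⇒∣m*n x (≈⇒∣ y y′ y≈)) (ℤS.∣m⇒∣m*n y′ (≈⇒∣ x x′ x≈)))
    where
    lemma : ∀ x x′ y y′ → x ℤ.* (y ℤ.- y′) ℤ.+ (x ℤ.- x′) ℤ.* y′ ≡ x ℤ.* y ℤ.- x′ ℤ.* y′
    lemma = solve-∀

  -‿cong : ∀ {x x′} → x ≈ x′ → ℤ.- x ≈ ℤ.- x′
  -‿cong {x} {x′} x≈ = ∣⇒≈ (ℤ.- x) (ℤ.- x′) (lemma x x′) (ℤS.∣m⇒∣-m (≈⇒∣ x x′ x≈))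
    where
    lemma : ∀ x x′ → ℤ.- (x ℤ.- x′) ≡ ℤ.- x ℤ.- ℤ.- x′
    lemma = solve-∀

  isCommutativeRing : IsCommutativeRing _≈_ ℤ._+_ ℤ._*_ ℤ.-_ (+ 0) (+ 1)
  isCommutativeRing = record
    { isRing = record
      { +-isAbelianGroup = record
        { isGroup = record
          { isMonoid = record
            { isSemigroup = record
              { isMagma = record
                { isEquivalence = record
                  { refl = λ {x} → ≈-reflexive {x} ≡.refl
                  ; sym = λ {x} {y} → ≈-sym {x} {y}
                  ; trans = λ {x} {y} {z} → ≈-trans {x} {y} {z} }
                ; ∙-cong = λ {x} {x′} {y} {y′} → +-cong {x} {x′} {y} {y′} }
              ; assoc = λ x y z → ≈-reflexive (ℤP.+-assoc x y z) }
            ; identity = (λ x → ≈-reflexive (ℤP.+-identityˡ x)) , (λ x → ≈-reflexive (ℤP.+-identityʳ x)) }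
          ; inverse = (λ x → ≈-reflexive (ℤP.+-inverseˡ x)) , (λ x → ≈-reflexive (ℤP.+-inverseʳ x))
          ; ⁻¹-cong = λ {x} {x′} → -‿cong {x} {x′} }
        ; comm = λ x y → ≈-reflexive (ℤP.+-comm x y) }
      ; *-cong = λ {x} {x′} {y} {y′} → *-cong {x} {x′} {y} {y′}
      ; *-assoc = λ x y z → ≈-reflexive (ℤP.*-assoc x y z)
      ; *-identity = (λ x → ≈-reflexive (ℤP.*-identityˡ x)) , (λ x → ≈-reflexive (ℤP.*-identityʳ x))
      ; distrib = (λ x y z → ≈-reflexive (ℤP.*-distribˡ-+ x y z)) , (λ x y z → ≈-reflexive (ℤP.*-distribʳ-+ x y z)) }
    ; *-comm = λ x y → ≈-reflexive (ℤP.*-comm x y) }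

  commutativeRing : CommutativeRing 0ℓ 0ℓ
  commutativeRing = record { isCommutativeRing = isCommutativeRing }

module Fermat {p : ℕ} (p-prime : Prime p) where
  open PrimeDivisibility p-prime
  open CongruenceModulo p using (_≈_; ≈⇒∣; ∣⇒≈; ≈-reflexive; commutativeRing)
  open CommutativeRing commutativeRing using (semiring; commutativeSemiring; setoid; +-cong; -‿cong)
  open import Relation.Binary.Reasoning.Setoid setoid
  open import Algebra.Properties.Semiring.Exp semiring using () renaming (_^_ to _^ᵉ_)
  open import Algebra.Properties.Semiring.Mult semiring using () renaming (_×_ to _×ᵐ_)
  open import Algebra.Properties.Semiring.Sum semiring using (sum; sum-init-last; sum-cong-≋; sum-replicate-zero)
  import Algebra.Properties.CommutativeSemiring.Binomial commutativeSemiring as Binomial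
  open import Data.Nat.Combinatorics using (_C_; nCn≡1; nCk≡n!/k![n-k]!; k![n∸k]!∣n!)
  open import Data.Nat.Base using (_!)
  open import Data.Nat.DivMod using (m/n*n≡m)
  open import Data.Fin as Fin using (Fin; toℕ; inject₁; fromℕ)
  import Data.Fin.Properties as FinP
  open import Data.Vec.Functional using (init; tail; last; replicate)

  p∤! : ∀ j → j ℕ.< p → ¬ p ℕD.∣ j !
  p∤! zero    _   = p∤1
  p∤! (suc j) j<p = p∤* (λ p∣1+j → ℕP.<⇒≱ j<p (ℕD.∣⇒≤ p∣1+j)) (p∤! j (ℕP.<-trans (ℕP.n<1+n j) j<p))

  p∣p! : p ℕD.∣ p !
  p∣p! with prime⇒≡2+ p-prime
  ... | m , ≡.refl = ℕD.m∣m*n ((suc m) !)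

  p∣pCk : ∀ k → 0 ℕ.< k → k ℕ.< p → p ℕD.∣ p C k
  p∣pCk k 0<k k<p with euclidsLemma (p C k) (k ! ℕ.* (p ∸ k) !) p-prime p∣pCk*k![p-k]!
    where
    instance
      _ : ℕ.NonZero (k ! ℕ.* (p ∸ k) !)
      _ = ℕP._!*_!≢0 k (p ∸ k)
    p∣pCk*k![p-k]! : p ℕD.∣ (p C k) ℕ.* (k ! ℕ.* (p ∸ k) !)
    p∣pCk*k![p-k]! = ≡.subst (p ℕD.∣_) (≡.sym (≡.trans
      (≡.cong (ℕ._* (k ! ℕ.* (p ∸ k) !)) (nCk≡n!/k![n-k]! (ℕP.<⇒≤ k<p)))
      (m/n*n≡m (k![n∸k]!∣n! (ℕP.<⇒≤ k<p))))) p∣p!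
  ... | inj₁ p∣pCk = p∣pCk
  ... | inj₂ p∣k![p-k]! = ⊥-elim (p∤* (p∤! k k<p) (p∤! (p ∸ k) (ℕP.∸-monoʳ-< {p} {k} {0} 0<k (ℕP.<⇒≤ k<p))) p∣k![p-k]!)

  ×ᵐ≡* : ∀ n z → n ×ᵐ z ≡ + n ℤ.* z
  ×ᵐ≡* zero    z = ≡.sym (ℤP.*-zeroˡ z)
  ×ᵐ≡* (suc n) z = ≡.trans (≡.cong (λ a → z ℤ.+ a) (×ᵐ≡* n z)) (lemma (+ n) z)
    where
    lemma : ∀ a z → z ℤ.+ a ℤ.* z ≡ (+ 1 ℤ.+ a) ℤ.* z
    lemma = solve-∀

  p∣⇒×ᵐ≈0 : ∀ k z → p ℕD.∣ k → k ×ᵐ z ≈ + 0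
  p∣⇒×ᵐ≈0 k z p∣k = ∣⇒≈ (k ×ᵐ z) (+ 0) (≡.trans (≡.sym (×ᵐ≡* k z)) (≡.sym (ℤP.+-identityʳ _)))
    (ℤS.∣m⇒∣m*n z (ℤS.∣ᵤ⇒∣ {+ p} {+ k} p∣k))

  -- p is written as N = 2 + m so that the first and last binomial terms compute
  module _ (m : ℕ) (p∣NCk : ∀ k → 0 ℕ.< k → k ℕ.< suc (suc m) → p ℕD.∣ suc (suc m) C k) where
    private
      N : ℕ
      N = suc (suc m)

    frobenius-2+ : ∀ x y → (x ℤ.+ y) ^ᵉ N ≈ x ^ᵉ N ℤ.+ y ^ᵉ N
    frobenius-2+ x y = begin
      (x ℤ.+ y) ^ᵉ N                                      ≈⟨ Binomial.theorem N x y ⟩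
      t Fin.zero ℤ.+ sum (tail t)                         ≈⟨ +-cong {t Fin.zero} {y ^ᵉ N} first (sum-init-last (tail t)) ⟩
      y ^ᵉ N ℤ.+ (sum (init (tail t)) ℤ.+ last (tail t))  ≈⟨ +-cong {y ^ᵉ N} {y ^ᵉ N} (≈-reflexive {y ^ᵉ N} ≡.refl)
                                                               (+-cong {sum (init (tail t))} {+ 0} middle lastTerm) ⟩
      y ^ᵉ N ℤ.+ (+ 0 ℤ.+ x ^ᵉ N)                         ≈⟨ ≈-reflexive (lemma (x ^ᵉ N) (y ^ᵉ N)) ⟩
      x ^ᵉ N ℤ.+ y ^ᵉ N                                   ∎
      where
      t : Fin (suc N) → ℤ
      t = Binomial.binomialTerm x y N
      lemma : ∀ a b → b ℤ.+ (+ 0 ℤ.+ a) ≡ a ℤ.+ b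
      lemma = solve-∀
      first : t Fin.zero ≈ y ^ᵉ N
      first = ≈-reflexive {t Fin.zero} (≡.trans (ℤP.+-identityʳ _) (ℤP.*-identityˡ _))
      middle : sum (init (tail t)) ≈ + 0
      middle = begin
        sum (init (tail t))        ≈⟨ sum-cong-≋ {suc m} {init (tail t)} {replicate (suc m) (+ 0)} (λ i →
                                        p∣⇒×ᵐ≈0 _ _ (p∣NCk (suc (toℕ (inject₁ i))) (ℕ.s≤s ℕ.z≤n)
                                          (ℕ.s≤s (≡.subst (ℕ._< suc m) (≡.sym (FinP.toℕ-inject₁ i)) (FinP.toℕ<n i))))) ⟩
        sum (replicate (suc m) (+ 0)) ≈⟨ sum-replicate-zero (suc m) ⟩
        + 0                        ∎
      lastTerm : last (tail t) ≈ x ^ᵉ N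
      lastTerm = termN (toℕ (Fin.suc (fromℕ (suc m)))) (≡.cong suc (FinP.toℕ-fromℕ (suc m)))
        where
        termN : ∀ k → k ≡ N → (N C k) ×ᵐ (x ^ᵉ k ℤ.* y ^ᵉ (N ∸ k)) ≈ x ^ᵉ N
        termN k ≡.refl rewrite nCn≡1 N | ℕP.n∸n≡0 N =
          ≈-reflexive (≡.trans (ℤP.+-identityʳ _) (ℤP.*-identityʳ (x ^ᵉ N)))

  frobenius : ∀ x y → (x ℤ.+ y) ^ᵉ p ≈ x ^ᵉ p ℤ.+ y ^ᵉ p
  frobenius with prime⇒≡2+ p-prime
  ... | m , ≡.refl = frobenius-2+ m p∣pCk

  0^p≈0 : (+ 0) ^ᵉ p ≈ + 0
  0^p≈0 with prime⇒≡2+ p-prime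
  ... | m , ≡.refl = ≈-reflexive (ℤP.*-zeroˡ ((+ 0) ^ᵉ suc m))

  ^ᵉ≡^ : ∀ x n → x ^ᵉ n ≡ x ℤ.^ n
  ^ᵉ≡^ x zero    = ≡.refl
  ^ᵉ≡^ x (suc n) = ≡.cong (x ℤ.*_) (^ᵉ≡^ x n)

  ℕ^p≈ℕ : ∀ a → (+ a) ^ᵉ p ≈ + a
  ℕ^p≈ℕ zero    = 0^p≈0
  ℕ^p≈ℕ (suc a) = begin
    (+ 1 ℤ.+ + a) ^ᵉ p          ≈⟨ frobenius (+ 1) (+ a) ⟩
    (+ 1) ^ᵉ p ℤ.+ (+ a) ^ᵉ p   ≈⟨ +-cong {(+ 1) ^ᵉ p} {+ 1} (≈-reflexive (≡.trans (^ᵉ≡^ (+ 1) p) (ℤP.^-zeroˡ p))) (ℕ^p≈ℕ a) ⟩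
    + 1 ℤ.+ + a                 ∎

  -^p≈- : ∀ x → x ^ᵉ p ≈ x → (ℤ.- x) ^ᵉ p ≈ ℤ.- x
  -^p≈- x x^p≈x = begin
    (ℤ.- x) ^ᵉ p                            ≈⟨ ≈-reflexive (lemma (x ^ᵉ p) ((ℤ.- x) ^ᵉ p)) ⟩
    (x ^ᵉ p ℤ.+ (ℤ.- x) ^ᵉ p) ℤ.- x ^ᵉ p    ≈⟨ +-cong {x ^ᵉ p ℤ.+ (ℤ.- x) ^ᵉ p} {+ 0} x^p+[-x]^p≈0 (-‿cong {x ^ᵉ p} {x} x^p≈x) ⟩
    + 0 ℤ.- x                               ≈⟨ ≈-reflexive (ℤP.+-identityˡ (ℤ.- x)) ⟩
    ℤ.- x                                   ∎
    where
    lemma : ∀ a b → b ≡ (a ℤ.+ b) ℤ.- a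
    lemma = solve-∀
    x^p+[-x]^p≈0 : x ^ᵉ p ℤ.+ (ℤ.- x) ^ᵉ p ≈ + 0
    x^p+[-x]^p≈0 = begin
      x ^ᵉ p ℤ.+ (ℤ.- x) ^ᵉ p   ≈⟨ frobenius x (ℤ.- x) ⟨
      (x ℤ.+ ℤ.- x) ^ᵉ p        ≡⟨ ≡.cong (_^ᵉ p) (ℤP.+-inverseʳ x) ⟩
      (+ 0) ^ᵉ p                ≈⟨ 0^p≈0 ⟩
      + 0                       ∎

  x^p≈x : ∀ x → x ^ᵉ p ≈ x
  x^p≈x (+ a)    = ℕ^p≈ℕ a
  x^p≈x -[1+ a ] = -^p≈- (+ suc a) (ℕ^p≈ℕ (suc a))

  fermat : ∀ x → ¬ p ℕD.∣ ∣ x ∣ → x ℤ.^ suc (p ∸ 2) ≈ + 1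
  fermat x p∤x with prime⇒≡2+ p-prime
  ... | m , ≡.refl with euclidsLemma ∣ x ∣ _ p-prime p∣x[x^[p-1]-1]
    where
    lemma : ∀ x y → x ℤ.* y ℤ.- x ≡ x ℤ.* (y ℤ.- + 1)
    lemma = solve-∀
    p∣x[x^[p-1]-1] : p ℕD.∣ ∣ x ∣ ℕ.* ∣ x ℤ.^ suc m ℤ.- + 1 ∣
    p∣x[x^[p-1]-1] = ≡.subst (p ℕD.∣_) (ℤP.abs-* x _)
      (≡.subst (λ z → p ℕD.∣ ∣ z ∣) (lemma x (x ℤ.^ suc m))
        (≡.subst (λ z → z ≈ x) (^ᵉ≡^ x p) (x^p≈x x)))
  ... | inj₁ p∣x        = ⊥-elim (p∤x p∣x)
  ... | inj₂ p∣x^[p-1]-1 = p∣x^[p-1]-1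

  isUnit⇒p∤ : ∀ x y → x ℤ.* y ≈ + 1 → ¬ p ℕD.∣ ∣ x ∣
  isUnit⇒p∤ x y xy≈1 p∣x = p∤1 (ℤS.∣⇒∣ᵤ {+ p} {+ 1} (≡.subst ((+ p) ℤS.∣_) (lemma (x ℤ.* y))
    (ℤS.∣m∣n⇒∣m-n (ℤS.∣m⇒∣m*n y (ℤS.∣ᵤ⇒∣ {+ p} {x} p∣x)) (≈⇒∣ (x ℤ.* y) (+ 1) xy≈1))))
    where
    lemma : ∀ a → a ℤ.- (a ℤ.- + 1) ≡ + 1
    lemma = solve-∀

module Rationals where
  open ≡.≡-Reasoning

  private
    toℚᵘ-ι : ∀ z → toℚᵘ (ι z) ℚᵘ.≃ mkℚᵘ z 0
    toℚᵘ-ι z = ℚP.toℚᵘ-fromℚᵘ (mkℚᵘ z 0)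

  ι-+ : ∀ a b → ι (a ℤ.+ b) ≡ ι a ℚ.+ ι b
  ι-+ a b = ℚP.toℚᵘ-injective (ℚᵘP.≃-trans (toℚᵘ-ι (a ℤ.+ b)) (ℚᵘP.≃-trans (*≡* (lemma a b))
    (ℚᵘP.≃-sym (ℚᵘP.≃-trans (ℚP.toℚᵘ-homo-+ (ι a) (ι b)) (ℚᵘP.+-cong (toℚᵘ-ι a) (toℚᵘ-ι b))))))
    where
    lemma : ∀ a b → (a ℤ.+ b) ℤ.* + 1 ≡ (a ℤ.* + 1 ℤ.+ b ℤ.* + 1) ℤ.* + 1
    lemma = solve-∀

  ι-* : ∀ a b → ι (a ℤ.* b) ≡ ι a ℚ.* ι b
  ι-* a b = ℚP.toℚᵘ-injective (ℚᵘP.≃-trans (toℚᵘ-ι (a ℤ.* b)) (ℚᵘP.≃-trans (*≡* ≡.refl)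
    (ℚᵘP.≃-sym (ℚᵘP.≃-trans (ℚP.toℚᵘ-homo-* (ι a) (ι b)) (ℚᵘP.*-cong (toℚᵘ-ι a) (toℚᵘ-ι b))))))

  ι-neg : ∀ a → ι (ℤ.- a) ≡ ℚ.- ι a
  ι-neg a = ℚP.toℚᵘ-injective (ℚᵘP.≃-trans (toℚᵘ-ι (ℤ.- a)) (ℚᵘP.≃-trans (*≡* ≡.refl)
    (ℚᵘP.≃-sym (ℚᵘP.≃-trans (ℚP.toℚᵘ-homo‿- (ι a)) (ℚᵘP.-‿cong (toℚᵘ-ι a))))))

  ι-injective : ∀ {a b} → ι a ≡ ι b → a ≡ b
  ι-injective {a} {b} ιa≡ιb
    with ℚᵘP.≃-trans (ℚᵘP.≃-sym (toℚᵘ-ι a)) (ℚᵘP.≃-trans (ℚP.toℚᵘ-cong ιa≡ιb) (toℚᵘ-ι b))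
  ... | *≡* a*1≡b*1 = ≡.trans (≡.sym (ℤP.*-identityʳ a)) (≡.trans a*1≡b*1 (ℤP.*-identityʳ b))

  invℚ-inverseʳ : ∀ q → q ≢ 0ℚ → q ℚ.* invℚ q ≡ 1ℚ
  invℚ-inverseʳ q q≢0 with q ℚP.≟ 0ℚ
  ... | yes q≡0 = contradiction q≡0 q≢0
  ... | no q≢0  = ℚP.*-inverseʳ q {{ℚ.≢-nonZero q≢0}}

  invℚ-inverseʳ′ : ∀ q {r} → q ℚ.* r ≡ 1ℚ → q ℚ.* invℚ q ≡ 1ℚ
  invℚ-inverseʳ′ q {r} qr≡1 = invℚ-inverseʳ q q≢0
    where
    q≢0 : q ≢ 0ℚ
    q≢0 ≡.refl = ℚP.1≢0 (≡.trans (≡.sym qr≡1) (ℚP.*-zeroˡ r))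

  ι-− : ∀ a b → ι a ℚ.- ι b ≡ ι (a ℤ.- b)
  ι-− a b = ≡.trans (≡.cong (ι a ℚ.+_) (≡.sym (ι-neg b))) (≡.sym (ι-+ a (ℤ.- b)))

  ι-≢0 : ∀ {a} → a ≢ + 0 → ι a ≢ 0ℚ
  ι-≢0 a≢0 ιa≡0 = a≢0 (ι-injective ιa≡0)

  q*ι[den]≡ι[num] : ∀ q → q ℚ.* ι (+ ℚ.denominatorℕ q) ≡ ι (ℚ.numerator q)
  q*ι[den]≡ι[num] q@(mkℚ n d _) = ℚP.toℚᵘ-injective (ℚᵘP.≃-trans (ℚP.toℚᵘ-homo-* q (ι (+ suc d)))
    (ℚᵘP.≃-trans (ℚᵘP.*-congˡ {toℚᵘ q} (toℚᵘ-ι (+ suc d))) (ℚᵘP.≃-trans (*≡* lemma) (ℚᵘP.≃-sym (toℚᵘ-ι n)))))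
    where
    lemma : (n ℤ.* + suc d) ℤ.* + 1 ≡ n ℤ.* + suc (d ℕ.* 1)
    lemma = ≡.trans (ℤP.*-identityʳ _) (≡.cong (λ k → n ℤ.* + suc k) (≡.sym (ℕP.*-identityʳ d)))

  -- in lowest terms n/(1+d), so q·b = a forces (1+d) ∣ b
  denominator-∣ : ∀ q a b → q ℚ.* ι b ≡ ι a → ℚ.denominatorℕ q ℕD.∣ ∣ b ∣
  denominator-∣ q@(mkℚ n d n⊥d) a b q*b≡a
    with ℚᵘP.≃-trans (ℚᵘP.≃-sym (ℚᵘP.≃-trans (ℚP.toℚᵘ-homo-* q (ι b)) (ℚᵘP.*-congˡ {toℚᵘ q} (toℚᵘ-ι b))))
                     (ℚᵘP.≃-trans (ℚP.toℚᵘ-cong q*b≡a) (toℚᵘ-ι a))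
  ... | *≡* nb*1≡a*den = Coprimality.coprime-divisor (Coprimality.sym (Coprimality.recompute n⊥d))
    (ℕD.divides ∣ a ∣ (begin
      ∣ n ∣ ℕ.* ∣ b ∣              ≡⟨ ℤP.abs-* n b ⟨
      ∣ n ℤ.* b ∣                  ≡⟨ ≡.cong ∣_∣ (≡.trans (≡.sym (ℤP.*-identityʳ (n ℤ.* b))) nb*1≡a*den) ⟩
      ∣ a ℤ.* + suc (d ℕ.* 1) ∣    ≡⟨ ≡.cong (λ k → ∣ a ℤ.* + suc k ∣) (ℕP.*-identityʳ d) ⟩
      ∣ a ℤ.* + suc d ∣            ≡⟨ ℤP.abs-* a (+ suc d) ⟩
      ∣ a ∣ ℕ.* suc d              ∎))

module LocalIntegers {p : ℕ} (p-prime : Prime p) where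
  open ≡.≡-Reasoning
  open Rationals
  open PrimeDivisibility p-prime
  open AmbOps (ℤₚAmb p) using (In; IsUnit)
  open IntegerCoefficients ℚP.+-*-commutativeRing using (solve; _:=_; _:+_; _:*_; con)

  private
    den : ℚ → ℤ
    den q = + ℚ.denominatorℕ q

    num : ℚ → ℤ
    num = ℚ.numerator

  In-fraction : ∀ q a b → q ℚ.* ι b ≡ ι a → ¬ p ℕD.∣ ∣ b ∣ → In q
  In-fraction q a b q*b≡a p∤b p∣den = p∤b (ℕD.∣-trans p∣den (denominator-∣ q a b q*b≡a))

  In-+ : ∀ {x y} → In x → In y → In (x ℚ.+ y)
  In-+ {x} {y} x∈ y∈ = In-fraction (x ℚ.+ y) (num x ℤ.* den y ℤ.+ num y ℤ.* den x) (den x ℤ.* den y) (begin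
      (x ℚ.+ y) ℚ.* ι (den x ℤ.* den y)                     ≡⟨ ≡.cong ((x ℚ.+ y) ℚ.*_) (ι-* (den x) (den y)) ⟩
      (x ℚ.+ y) ℚ.* (ι (den x) ℚ.* ι (den y))               ≡⟨ solve 4 (λ x y a b → (x :+ y) :* (a :* b) := x :* a :* b :+ y :* b :* a) ≡.refl x y (ι (den x)) (ι (den y)) ⟩
      x ℚ.* ι (den x) ℚ.* ι (den y) ℚ.+ y ℚ.* ι (den y) ℚ.* ι (den x)
        ≡⟨ ≡.cong₂ ℚ._+_ (≡.cong (ℚ._* ι (den y)) (q*ι[den]≡ι[num] x)) (≡.cong (ℚ._* ι (den x)) (q*ι[den]≡ι[num] y)) ⟩
      ι (num x) ℚ.* ι (den y) ℚ.+ ι (num y) ℚ.* ι (den x)   ≡⟨ ≡.cong₂ ℚ._+_ (ι-* (num x) (den y)) (ι-* (num y) (den x)) ⟨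
      ι (num x ℤ.* den y) ℚ.+ ι (num y ℤ.* den x)           ≡⟨ ι-+ (num x ℤ.* den y) (num y ℤ.* den x) ⟨
      ι (num x ℤ.* den y ℤ.+ num y ℤ.* den x)               ∎)
    (≡.subst (λ k → ¬ p ℕD.∣ k) (≡.sym (ℤP.abs-* (den x) (den y))) (p∤* x∈ y∈))

  In-* : ∀ {x y} → In x → In y → In (x ℚ.* y)
  In-* {x} {y} x∈ y∈ = In-fraction (x ℚ.* y) (num x ℤ.* num y) (den x ℤ.* den y) (begin
      (x ℚ.* y) ℚ.* ι (den x ℤ.* den y)             ≡⟨ ≡.cong ((x ℚ.* y) ℚ.*_) (ι-* (den x) (den y)) ⟩
      (x ℚ.* y) ℚ.* (ι (den x) ℚ.* ι (den y))       ≡⟨ solve 4 (λ x y a b → (x :* y) :* (a :* b) := x :* a :* (y :* b)) ≡.refl x y (ι (den x)) (ι (den y)) ⟩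
      x ℚ.* ι (den x) ℚ.* (y ℚ.* ι (den y))         ≡⟨ ≡.cong₂ ℚ._*_ (q*ι[den]≡ι[num] x) (q*ι[den]≡ι[num] y) ⟩
      ι (num x) ℚ.* ι (num y)                       ≡⟨ ι-* (num x) (num y) ⟨
      ι (num x ℤ.* num y)                           ∎)
    (≡.subst (λ k → ¬ p ℕD.∣ k) (≡.sym (ℤP.abs-* (den x) (den y))) (p∤* x∈ y∈))

  In-neg : ∀ {x} → In x → In (ℚ.- x)
  In-neg {x} x∈ = In-fraction (ℚ.- x) (ℤ.- num x) (den x)
    (≡.trans (≡.sym (ℚP.neg-distribˡ-* x (ι (den x)))) (≡.trans (≡.cong ℚ.-_ (q*ι[den]≡ι[num] x)) (≡.sym (ι-neg (num x)))))
    x∈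

  In-ι : ∀ z → In (ι z)
  In-ι z = In-fraction (ι z) z (+ 1) (ℚP.*-identityʳ (ι z)) p∤1

  isRingWithSubring : IsRingWithSubring (ℤₚAmb p)
  isRingWithSubring = record
    { isCommutativeRing = ℚP.+-*-isCommutativeRing ; In-resp = λ { ≡.refl x∈ → x∈ }
    ; In-+ = λ {x} {y} → In-+ {x} {y} ; In-* = λ {x} {y} → In-* {x} {y} ; In-neg = λ {x} → In-neg {x}
    ; In-1 = In-ι (+ 1) }

  isUnit-fraction : ∀ q a b → q ℚ.* ι b ≡ ι a → ¬ p ℕD.∣ ∣ a ∣ → ¬ p ℕD.∣ ∣ b ∣ → IsUnit q
  isUnit-fraction q a b q*b≡a p∤a p∤b =
    In-fraction q a b q*b≡a p∤b , invℚ q , In-fraction (invℚ q) b a q⁻¹*a≡b p∤a , invℚ-inverseʳ q q≢0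
    where
    q≢0 : q ≢ 0ℚ
    q≢0 ≡.refl = p∤a (≡.subst (λ a → p ℕD.∣ ∣ a ∣) (≡.sym (ι-injective {a} {+ 0} (≡.trans (≡.sym q*b≡a) (ℚP.*-zeroˡ (ι b))))) (p ℕD.∣0))
    q⁻¹*a≡b : invℚ q ℚ.* ι a ≡ ι b
    q⁻¹*a≡b = begin
      invℚ q ℚ.* ι a             ≡⟨ ≡.cong (invℚ q ℚ.*_) q*b≡a ⟨
      invℚ q ℚ.* (q ℚ.* ι b)     ≡⟨ ℚP.*-assoc (invℚ q) q (ι b) ⟨
      (invℚ q ℚ.* q) ℚ.* ι b     ≡⟨ ≡.cong (ℚ._* ι b) (≡.trans (ℚP.*-comm (invℚ q) q) (invℚ-inverseʳ q q≢0)) ⟩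
      1ℚ ℚ.* ι b                 ≡⟨ ℚP.*-identityˡ (ι b) ⟩
      ι b                        ∎

  isUnit-ι : ∀ e → ¬ p ℕD.∣ ∣ e ∣ → IsUnit (ι e)
  isUnit-ι e p∤e = isUnit-fraction (ι e) e (+ 1) (ℚP.*-identityʳ (ι e)) p∤e p∤1

  -- (1 + pʲ⁺¹z)·den z = den z + pʲ⁺¹·num z, which p does not divide
  isUnit-1+p^[1+j]* : ∀ j {z} → In z → IsUnit (1ℚ ℚ.+ ι (+ (p ℕ.^ suc j)) ℚ.* z)
  isUnit-1+p^[1+j]* j {z} z∈ = isUnit-fraction (1ℚ ℚ.+ ι π ℚ.* z) M (den z) y*den≡M p∤M z∈
    where
    π M : ℤ
    π = + (p ℕ.^ suc j)
    M = den z ℤ.+ π ℤ.* num z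
    y*den≡M : (1ℚ ℚ.+ ι π ℚ.* z) ℚ.* ι (den z) ≡ ι M
    y*den≡M = begin
      (1ℚ ℚ.+ ι π ℚ.* z) ℚ.* ι (den z)      ≡⟨ solve 3 (λ a b c → (con (+ 1) :+ a :* b) :* c := c :+ a :* (b :* c)) ≡.refl (ι π) z (ι (den z)) ⟩
      ι (den z) ℚ.+ ι π ℚ.* (z ℚ.* ι (den z)) ≡⟨ ≡.cong (λ x → ι (den z) ℚ.+ ι π ℚ.* x) (q*ι[den]≡ι[num] z) ⟩
      ι (den z) ℚ.+ ι π ℚ.* ι (num z)       ≡⟨ ≡.cong (ι (den z) ℚ.+_) (ι-* π (num z)) ⟨
      ι (den z) ℚ.+ ι (π ℤ.* num z)         ≡⟨ ι-+ (den z) (π ℤ.* num z) ⟨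
      ι M                                   ∎
    p∣π : (+ p) ℤS.∣ π
    p∣π = ≡.subst ((+ p) ℤS.∣_) (≡.sym (ℤP.pos-* p (p ℕ.^ j))) (ℤS.∣m⇒∣m*n (+ (p ℕ.^ j)) ℤS.∣-refl)
    p∤M : ¬ p ℕD.∣ ∣ M ∣
    p∤M p∣M = z∈ (ℤS.∣⇒∣ᵤ {+ p} {den z} (≡.subst ((+ p) ℤS.∣_) (lemma (den z) (π ℤ.* num z))
      (ℤS.∣m∣n⇒∣m-n (ℤS.∣ᵤ⇒∣ {+ p} {M} p∣M) (ℤS.∣m⇒∣m*n (num z) p∣π))))
      where
      lemma : ∀ a b → a ℤ.+ b ℤ.- b ≡ a
      lemma = solve-∀

disc-roots : ∀ a b → disc (a ℤ.+ b) (a ℤ.* b) ≡ (a ℤ.- b) ℤ.* (a ℤ.- b)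
disc-roots = lemma
  where
  lemma : ∀ a b → (a ℤ.+ b) ℤ.* (a ℤ.+ b) ℤ.- + 4 ℤ.* (a ℤ.* b) ≡ (a ℤ.- b) ℤ.* (a ℤ.- b)
  lemma = solve-∀

ι-roots-distinct : ∀ {P Q} θ₁ θ₂ → P ≡ θ₁ ℤ.+ θ₂ → Q ≡ θ₁ ℤ.* θ₂ → disc P Q ≢ + 0 → ι θ₁ ℚ.- ι θ₂ ≢ 0ℚ
ι-roots-distinct θ₁ θ₂ ≡.refl ≡.refl D≢0 δ≡0 = D≢0 (≡.trans (disc-roots θ₁ θ₂)
  (≡.cong (λ a → a ℤ.* a) (Rationals.ι-injective {θ₁ ℤ.- θ₂} {+ 0} (≡.trans (≡.sym (Rationals.ι-− θ₁ θ₂)) δ≡0))))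

p∣square : ∀ {p} a → (+ p) ℤS.∣ a → p ℕD.∣ ∣ a ℤ.* a ∣
p∣square {p} a p∣a = ℤS.∣⇒∣ᵤ {+ p} {a ℤ.* a} (ℤS.∣m⇒∣m*n a p∣a)

module OverRationals (P Q : ℤ) (Q≢0 : Q ≢ + 0) (D≢0 : disc P Q ≢ + 0) where
  open Rationals

  isRingWithSubring : IsRingWithSubring ℚAmb
  isRingWithSubring = record
    { isCommutativeRing = ℚP.+-*-isCommutativeRing
    ; In-resp = λ _ _ → tt ; In-+ = λ _ _ → tt ; In-* = λ _ _ → tt ; In-neg = λ _ → tt ; In-1 = tt }

  open RingWithSubring ℚAmb isRingWithSubring
  open Sequences (ι P) (ι Q) tt (tt , invℚ (ι Q) , tt , invℚ-inverseʳ (ι Q) (ι-≢0 Q≢0))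

  quadMap-isIsoℚ : IsIso ℚAmb (ι P) (ι Q) (QuadModUnits ℚAmb (ι P) (ι Q)) (quadMap ℚAmb (ι P) (ι Q))
  quadMap-isIsoℚ = quadMap-isIso

  ratioMap-isIsoℚ : ∀ θ₁ θ₂ → P ≡ θ₁ ℤ.+ θ₂ → Q ≡ θ₁ ℤ.* θ₂ →
                    IsIso ℚAmb (ι P) (ι Q) (MulGroup ℚAmb (ι P) (ι Q) (AmbOps.IsUnit ℚAmb))
                      (ratioMap ℚAmb (ι P) (ι Q) invℚ (ι θ₁) (ι θ₂))
  ratioMap-isIsoℚ θ₁ θ₂ ≡.refl ≡.refl = Split.ratio-isIso-units invℚ (λ {x} (_ , _ , _ , xy≡1) → invℚ-inverseʳ′ x xy≡1)
    (ι θ₁) (ι θ₂) tt tt (ι-+ θ₁ θ₂) (ι-* θ₁ θ₂) (invℚ (ι θ₁ ℚ.- ι θ₂)) (invℚ-inverseʳ _ (ι-roots-distinct θ₁ θ₂ ≡.refl ≡.refl D≢0)) tt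

[k+k]/2≡k : ∀ k → (k ℕ.+ k) / 2 ≡ k
[k+k]/2≡k k = ≡.trans (≡.cong (_/ 2) (≡.trans (≡.cong (k ℕ.+_) (≡.sym (ℕP.*-identityʳ k))) (≡.sym (ℕP.*-suc k 1))))
                      (m*n/n≡m k 2)

module OverLocalIntegers (P Q : ℤ) {p : ℕ} (p-prime : Prime p) (D≢0 : disc P Q ≢ + 0) (p∤Q : ¬ (+ p) ℤD.∣ Q)
                         (s : ℕ) (D₀ : ℤ) (D≡ : disc P Q ≡ + (p ℕ.^ s) ℤ.* D₀) (p∤D₀ : ¬ (+ p) ℤD.∣ D₀) where
  open Rationals
  open LocalIntegers p-prime
  open PrimeDivisibility p-prime using (square-valuation)
  open AmbOps (ℤₚAmb p) using (IsUnit)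
  open RingWithSubring (ℤₚAmb p) isRingWithSubring
  open Sequences (ι P) (ι Q) (In-ι P) (isUnit-ι Q p∤Q)

  invℚ-correct : ∀ {x} → IsUnit x → x ℚ.* invℚ x ≡ 1ℚ
  invℚ-correct {x} (_ , _ , _ , xy≡1) = invℚ-inverseʳ′ x xy≡1

  quadMap-isIsoℤₚ : IsIso (ℤₚAmb p) (ι P) (ι Q) (QuadModUnits (ℤₚAmb p) (ι P) (ι Q)) (quadMap (ℤₚAmb p) (ι P) (ι Q))
  quadMap-isIsoℤₚ = quadMap-isIso

  module SplitCase (θ₁ θ₂ : ℤ) (P≡ : P ≡ θ₁ ℤ.+ θ₂) (Q≡ : Q ≡ θ₁ ℤ.* θ₂) where

    D≡δ² : disc P Q ≡ (θ₁ ℤ.- θ₂) ℤ.* (θ₁ ℤ.- θ₂)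
    D≡δ² = ≡.trans (≡.cong₂ disc P≡ Q≡) (disc-roots θ₁ θ₂)

    open Split invℚ (λ {x} → invℚ-correct {x}) (ι θ₁) (ι θ₂) (In-ι θ₁) (In-ι θ₂)
      (≡.trans (≡.cong ι P≡) (ι-+ θ₁ θ₂)) (≡.trans (≡.cong ι Q≡) (ι-* θ₁ θ₂))
      (invℚ (ι θ₁ ℚ.- ι θ₂)) (invℚ-inverseʳ _ (ι-roots-distinct θ₁ θ₂ P≡ Q≡ D≢0))

    ratioMap-isIso-p∤D : ¬ (+ p) ℤD.∣ disc P Q →
                         IsIso (ℤₚAmb p) (ι P) (ι Q) (MulGroup (ℤₚAmb p) (ι P) (ι Q) IsUnit)
                           (ratioMap (ℤₚAmb p) (ι P) (ι Q) invℚ (ι θ₁) (ι θ₂))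
    ratioMap-isIso-p∤D p∤D = ratio-isIso-units (Inverse.inv-∈ invℚ (λ {x} → invℚ-correct {x}) {ι θ₁ ℚ.- ι θ₂} δ-unit)
      where
      p∤δ : ¬ p ℕD.∣ ∣ θ₁ ℤ.- θ₂ ∣
      p∤δ p∣δ = p∤D (≡.subst (λ d → p ℕD.∣ ∣ d ∣) (≡.sym D≡δ²) (p∣square (θ₁ ℤ.- θ₂) (ℤS.∣ᵤ⇒∣ {+ p} {θ₁ ℤ.- θ₂} p∣δ)))
      δ-unit : IsUnit (ι θ₁ ℚ.- ι θ₂)
      δ-unit = ≡.subst IsUnit (≡.sym (ι-− θ₁ θ₂)) (isUnit-ι (θ₁ ℤ.- θ₂) p∤δ)

    -- δ² = pˢD₀ gives δ = pᵏe with s = 2k, and k > 0 because p ∣ D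
    ratioMap-isIso-p∣D : (+ p) ℤD.∣ disc P Q →
                         IsIso (ℤₚAmb p) (ι P) (ι Q) (MulGroup (ℤₚAmb p) (ι P) (ι Q) (OnePlus p (s / 2)))
                           (ratioMap (ℤₚAmb p) (ι P) (ι Q) invℚ (ι θ₁) (ι θ₂))
    ratioMap-isIso-p∣D p∣D
      with square-valuation s (θ₁ ℤ.- θ₂) D₀ (≡.trans (≡.sym D≡δ²) D≡) (λ p∣D₀ → p∤D₀ (ℤS.∣⇒∣ᵤ p∣D₀))
    ... | zero , _ , ≡.refl , _ , _ = ⊥-elim (p∤D₀ (≡.subst (λ d → p ℕD.∣ ∣ d ∣) (≡.trans D≡ (ℤP.*-identityˡ D₀)) p∣D))
    ... | suc j , e , s≡ , δ≡pᵏe , p∤e = ratio-isIso-≡1-mod {ι (+ (p ℕ.^ (s / 2)))} {ι e} δ≡πε (isUnit-ι e (λ p∣e → p∤e (ℤS.∣ᵤ⇒∣ {+ p} {e} p∣e))) ≡1⇒unit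
      where
      s/2≡ : s / 2 ≡ suc j
      s/2≡ = ≡.trans (≡.cong (_/ 2) s≡) ([k+k]/2≡k (suc j))
      δ≡πε : ι θ₁ ℚ.- ι θ₂ ≡ ι (+ (p ℕ.^ (s / 2))) ℚ.* ι e
      δ≡πε = ≡.trans (ι-− θ₁ θ₂) (≡.trans (≡.cong ι δ≡pᵏe)
               (≡.trans (ι-* (+ (p ℕ.^ suc j)) e) (≡.cong (λ k → ι (+ (p ℕ.^ k)) ℚ.* ι e) (≡.sym s/2≡))))
      ≡1⇒unit : ∀ {y} → OnePlus p (s / 2) y → IsUnit y
      ≡1⇒unit (z , z∈ , y≡) = ≡.subst IsUnit (≡.sym y≡)
        (≡.subst (λ k → IsUnit (1ℚ ℚ.+ ι (+ (p ℕ.^ k)) ℚ.* z)) (≡.sym s/2≡) (isUnit-1+p^[1+j]* j z∈))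

module OverFiniteField (P Q : ℤ) {p : ℕ} (p-prime : Prime p) (p∤Q : ¬ (+ p) ℤD.∣ Q) where
  open CongruenceModulo p using (_≈_; isCommutativeRing; ≈-reflexive; ≈-trans; ≈⇒∣) renaming (+-cong to +≈; *-cong to *≈; -‿cong to -≈)
  open Fermat p-prime using (fermat; isUnit⇒p∤)
  open AmbOps (𝔽Amb p) using (IsUnit)

  isRingWithSubring : IsRingWithSubring (𝔽Amb p)
  isRingWithSubring = record
    { isCommutativeRing = isCommutativeRing
    ; In-resp = λ _ _ → tt ; In-+ = λ _ _ → tt ; In-* = λ _ _ → tt ; In-neg = λ _ → tt ; In-1 = tt }

  open RingWithSubring (𝔽Amb p) isRingWithSubring
  open Sequences P Q tt (tt , inv𝔽 p Q , tt , fermat Q p∤Q)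

  inv𝔽-correct : ∀ {x} → IsUnit x → x ℤ.* inv𝔽 p x ≈ + 1
  inv𝔽-correct {x} (_ , y , _ , xy≈1) = fermat x (isUnit⇒p∤ x y xy≈1)

  quadMap-isIso𝔽 : IsIso (𝔽Amb p) P Q (QuadModUnits (𝔽Amb p) P Q) (quadMap (𝔽Amb p) P Q)
  quadMap-isIso𝔽 = quadMap-isIso

  disc-cong : ∀ {P′ Q′} → P ≈ P′ → Q ≈ Q′ → disc P Q ≈ disc P′ Q′
  disc-cong {P′} {Q′} P≈ Q≈ = +≈ {P ℤ.* P} {P′ ℤ.* P′} {ℤ.- (+ 4 ℤ.* Q)} {ℤ.- (+ 4 ℤ.* Q′)} (*≈ {P} {P′} {P} {P′} P≈ P≈)
    (-≈ {+ 4 ℤ.* Q} {+ 4 ℤ.* Q′} (*≈ {+ 4} {+ 4} {Q} {Q′} (≈-reflexive {+ 4} ≡.refl) Q≈))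

  ratioMap-isIso𝔽 : ∀ θ₁ θ₂ → P ≈ θ₁ ℤ.+ θ₂ → Q ≈ θ₁ ℤ.* θ₂ → ¬ (+ p) ℤD.∣ disc P Q →
                    IsIso (𝔽Amb p) P Q (MulGroup (𝔽Amb p) P Q IsUnit) (ratioMap (𝔽Amb p) P Q (inv𝔽 p) θ₁ θ₂)
  ratioMap-isIso𝔽 θ₁ θ₂ P≈ Q≈ p∤D =
    Split.ratio-isIso-units (inv𝔽 p) (λ {x} → inv𝔽-correct {x}) θ₁ θ₂ tt tt P≈ Q≈ (inv𝔽 p δ) (fermat δ p∤δ) tt
    where
    δ : ℤ
    δ = θ₁ ℤ.- θ₂
    D≈δ² : disc P Q ≈ δ ℤ.* δ
    D≈δ² = ≈-trans {disc P Q} (disc-cong P≈ Q≈) (≈-reflexive (disc-roots θ₁ θ₂))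
    p∤δ : ¬ p ℕD.∣ ∣ δ ∣
    p∤δ p∣δ = p∤D (ℤS.∣⇒∣ᵤ {+ p} {disc P Q} (≡.subst ((+ p) ℤS.∣_) lemma
      (ℤS.∣m∣n⇒∣m+n (≈⇒∣ (disc P Q) (δ ℤ.* δ) D≈δ²) (ℤS.∣m⇒∣m*n δ (ℤS.∣ᵤ⇒∣ {+ p} {δ} p∣δ)))))
      where
      lemma : disc P Q ℤ.- δ ℤ.* δ ℤ.+ δ ℤ.* δ ≡ disc P Q
      lemma = solve′ (disc P Q) (δ ℤ.* δ)
        where
        solve′ : ∀ a b → a ℤ.- b ℤ.+ b ≡ a
        solve′ = solve-∀

  additiveMap-isIso𝔽 : ∀ θ → P ≈ + 2 ℤ.* θ → Q ≈ θ ℤ.* θ →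
                       IsIso (𝔽Amb p) P Q (AddGroup (𝔽Amb p) P Q) (additiveMap (𝔽Amb p) P Q (inv𝔽 p) θ)
  additiveMap-isIso𝔽 θ P≈2θ Q≈θ² = DoubleRoot.additive-isIso (inv𝔽 p) (λ {x} → inv𝔽-correct {x}) θ tt
    (≈-trans {P} P≈2θ (≈-reflexive (lemma θ))) Q≈θ²
    where
    lemma : ∀ t → + 2 ℤ.* t ≡ t ℤ.+ t
    lemma = solve-∀

theorem5 :
  (P Q : ℤ) (p : ℕ) → Prime p → Q ≢ + 0 → disc P Q ≢ + 0 → ¬ ((+ p) ℤD.∣ Q) →
  (s : ℕ) (D₀ : ℤ) → disc P Q ≡ + (p ℕ.^ s) ℤ.* D₀ → ¬ ((+ p) ℤD.∣ D₀) →
  -- (1) R = ℚ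
  ( (Irreducible ℚAmb (ι P) (ι Q) →
      IsIso ℚAmb (ι P) (ι Q) (QuadModUnits ℚAmb (ι P) (ι Q)) (quadMap ℚAmb (ι P) (ι Q)))
  × ((θ₁ θ₂ : ℤ) → P ≡ θ₁ ℤ.+ θ₂ → Q ≡ θ₁ ℤ.* θ₂ →
      IsIso ℚAmb (ι P) (ι Q) (MulGroup ℚAmb (ι P) (ι Q) (AmbOps.IsUnit ℚAmb))
        (ratioMap ℚAmb (ι P) (ι Q) invℚ (ι θ₁) (ι θ₂))) )
  ×
  -- (2) R = ℤ_(p)
  ( (Irreducible ℚAmb (ι P) (ι Q) →
      IsIso (ℤₚAmb p) (ι P) (ι Q) (QuadModUnits (ℤₚAmb p) (ι P) (ι Q)) (quadMap (ℤₚAmb p) (ι P) (ι Q)))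
  × ((θ₁ θ₂ : ℤ) → P ≡ θ₁ ℤ.+ θ₂ → Q ≡ θ₁ ℤ.* θ₂ →
      (¬ ((+ p) ℤD.∣ disc P Q) →
        IsIso (ℤₚAmb p) (ι P) (ι Q) (MulGroup (ℤₚAmb p) (ι P) (ι Q) (AmbOps.IsUnit (ℤₚAmb p)))
          (ratioMap (ℤₚAmb p) (ι P) (ι Q) invℚ (ι θ₁) (ι θ₂)))
    × ((+ p) ℤD.∣ disc P Q →
        IsIso (ℤₚAmb p) (ι P) (ι Q) (MulGroup (ℤₚAmb p) (ι P) (ι Q) (OnePlus p (s / 2)))
          (ratioMap (ℤₚAmb p) (ι P) (ι Q) invℚ (ι θ₁) (ι θ₂)))) )
  ×
  -- (3) R = 𝔽_p
  ( (Irreducible (𝔽Amb p) P Q →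
      IsIso (𝔽Amb p) P Q (QuadModUnits (𝔽Amb p) P Q) (quadMap (𝔽Amb p) P Q))
  × ((θ₁ θ₂ : ℤ) → P ≡ θ₁ ℤ.+ θ₂ [mod p ] → Q ≡ θ₁ ℤ.* θ₂ [mod p ] →
      ¬ ((+ p) ℤD.∣ disc P Q) →
      IsIso (𝔽Amb p) P Q (MulGroup (𝔽Amb p) P Q (AmbOps.IsUnit (𝔽Amb p)))
        (ratioMap (𝔽Amb p) P Q (inv𝔽 p) θ₁ θ₂))
  × ((θ : ℤ) → P ≡ + 2 ℤ.* θ [mod p ] → Q ≡ θ ℤ.* θ [mod p ] →
      (+ p) ℤD.∣ disc P Q →
      IsIso (𝔽Amb p) P Q (AddGroup (𝔽Amb p) P Q) (additiveMap (𝔽Amb p) P Q (inv𝔽 p) θ)) )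
-- The irreducibility hypotheses are unused: the map to R[θ]^×/R^× is an isomorphism for every f.
theorem5 P Q p p-prime Q≢0 D≢0 p∤Q s D₀ D≡ p∤D₀ =
  ((λ _ → quadMap-isIsoℚ) , ratioMap-isIsoℚ) ,
  ((λ _ → quadMap-isIsoℤₚ) , (λ θ₁ θ₂ P≡ Q≡ → let open SplitCase θ₁ θ₂ P≡ Q≡ in ratioMap-isIso-p∤D , ratioMap-isIso-p∣D)) ,
  ((λ _ → quadMap-isIso𝔽) , ratioMap-isIso𝔽 , (λ θ P≈ Q≈ _ → additiveMap-isIso𝔽 θ P≈ Q≈))
  where
  open OverRationals P Q Q≢0 D≢0
  open OverLocalIntegers P Q p-prime D≢0 p∤Q s D₀ D≡ p∤D₀
  open OverFiniteField P Q p-prime p∤Q
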